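{- For every $w\in S_n$, \[\nu_w=|\mathrm{bpd}(w)|\le \sum_{u\le w}|\mathrm{mbpd}(u)|\cdot p_u(w).\]
   Context: Permutations are written in one-line notation. A bumpless pipe dream (BPD) of size $n$ is a tiling of the $n\times n$ grid (rows top to bottom, columns left to right) by six tiles: blank, cross (vertical and horizontal segment crossing), horizontal, vertical, r-elbow (joining south edge to east edge) and j-elbow (joining west edge to north edge), such that the segments form $n$ pipes, each moving only north and east, entering through the bottom of one column and exiting through the right end of one row, one per column and per row. A pipe from column $j$ to row $i$ is denoted $j\rightarrow i$, and the permutation $w_B$ of $B$ satisfies $w_B(i)=j$. $B$ is reduced if any two pipes cross at most once; $\mathrm{bpd}(w)$ is the set of reduced BPDs with permutation $w$, and $\nu_w=\mathfrak S_w(1,\dots,1)$ is the principal specialization of the Schubert polynomial, which equals $|\mathrm{bpd}(w)|$. A pipe $j\rightarrow i$ is removable if the tile at $(i,j)$ is an r-elbow and it is the only r-elbow in row $i$ and in column $j$; a BPD is minimal if it has no removable pipe; $\mathrm{mbpd}(u)$ is the set of minimal reduced BPDs with permutation $u$ (for the empty permutation $\emptyset$, $\mathrm{mbpd}(\emptyset)$ consists of the single empty BPD). For $u\in S_m$, $p_u(w)$ is the number of occurrences of the pattern $u$ in $w$, i.e. the number of subsequences of the one-line notation of $w$ whose standardization is $u$; $u\le w$ means $u$ is contained in $w$ as a pattern, and the sum ranges over permutations $u$ of all sizes $0\le m\le n$, including the empty permutation. -}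

module Defs where

open import Data.Nat using (ℕ; zero; suc; _+_; _*_; _∸_; _≡ᵇ_; _<ᵇ_; _≤ᵇ_)
open import Data.Bool using (Bool; true; false; not; _∧_; _∨_; if_then_else_)
open import Data.List using (List; []; _∷_; [_]; _++_; map; concatMap; length; filterᵇ; upTo; allFin)
open import Data.Bool.ListAction using (and; or)
open import Data.Nat.ListAction using (sum)
open import Data.Maybe using (Maybe; just; nothing)
open import Data.Product using (_×_; _,_)
open import Data.Fin using (Fin; toℕ)
open import Data.Vec as V using (Vec)
open import Data.Fin.Permutation using (Permutation′; _⟨$⟩ʳ_)

allB : {n : ℕ} → (Fin n → Bool) → Bool
allB {n} p = and (map p (allFin n))

anyB : {n : ℕ} → (Fin n → Bool) → Bool
anyB {n} p = or (map p (allFin n))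

eqBool : Bool → Bool → Bool
eqBool a b = if a then b else not b

eqFin : {n : ℕ} → Fin n → Fin n → Bool
eqFin a b = toℕ a ≡ᵇ toℕ b

eqPair : ℕ × ℕ → ℕ × ℕ → Bool
eqPair (a , b) (c , d) = (a ≡ᵇ c) ∧ (b ≡ᵇ d)

elemP : ℕ × ℕ → List (ℕ × ℕ) → Bool
elemP x ys = or (map (eqPair x) ys)

eqListℕ : List ℕ → List ℕ → Bool
eqListℕ [] [] = true
eqListℕ (x ∷ xs) (y ∷ ys) = (x ≡ᵇ y) ∧ eqListℕ xs ys
eqListℕ _ _ = false

getD : {A : Set} → List A → ℕ → A → A
getD [] _ d = d
getD (x ∷ xs) zero d = x
getD (x ∷ xs) (suc i) d = getD xs i d

allVecs : {A : Set} → (n : ℕ) → List A → List (Vec A n)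
allVecs zero xs = [ V.[] ]
allVecs (suc n) xs = concatMap (λ x → map (x V.∷_) (allVecs n xs)) xs

-- v is a permutation of {0..m-1} in one-line notation: v(i) = lookup v i
isPermVec : {m : ℕ} → Vec (Fin m) m → Bool
isPermVec v = allB λ a → allB λ b → eqFin a b ∨ not (eqFin (V.lookup v a) (V.lookup v b))

-- all permutations of size m (m = 0 gives the single empty permutation)
perms : (m : ℕ) → List (Vec (Fin m) m)
perms m = filterᵇ isPermVec (allVecs m (allFin m))

oneLineVec : {n : ℕ} → Permutation′ n → Vec (Fin n) n
oneLineVec w = V.tabulate (λ i → w ⟨$⟩ʳ i)

subsequences : List ℕ → List (List ℕ)
subsequences [] = [ [] ]
subsequences (x ∷ xs) = map (x ∷_) (subsequences xs) ++ subsequences xs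

standardize : List ℕ → List ℕ
standardize s = map (λ x → length (filterᵇ (λ y → y <ᵇ x) s)) s

patCount : {m n : ℕ} → Vec (Fin m) m → Vec (Fin n) n → ℕ
patCount u w =
  length (filterᵇ (λ s → eqListℕ (standardize s) (V.toList (V.map toℕ u)))
                  (subsequences (V.toList (V.map toℕ w))))

-- u ≤ w : u is contained in w as a pattern
containsB : {m n : ℕ} → Vec (Fin m) m → Vec (Fin n) n → Bool
containsB u w = 1 ≤ᵇ patCount u w

data Tile : Set where
  blank cross hor vert relb jelb : Tile
-- relb : r-elbow (south edge to east edge); jelb : j-elbow (west edge to north edge)

allTiles : List Tile
allTiles = blank ∷ cross ∷ hor ∷ vert ∷ relb ∷ jelb ∷ []

northE southE eastE westE : Tile → Bool
northE cross = true
northE vert = true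
northE jelb = true
northE _ = false
southE cross = true
southE vert = true
southE relb = true
southE _ = false
eastE cross = true
eastE hor = true
eastE relb = true
eastE _ = false
westE cross = true
westE hor = true
westE jelb = true
westE _ = false

isRelb : Tile → Bool
isRelb relb = true
isRelb _ = false

-- n×n grid of tiles, rows top to bottom (index 0 = top), columns left to right
Grid : ℕ → Set
Grid n = Vec (Vec Tile n) n

allGrids : (n : ℕ) → List (Grid n)
allGrids n = allVecs n (allVecs n allTiles)

-- tile at (row i, column j); blank outside the grid
tileAt : {n : ℕ} → Grid n → ℕ → ℕ → Tile
tileAt G i j = getD (getD (V.toList (V.map V.toList G)) i []) j blank

-- local consistency: segments match across shared edges; every bottom
-- edge and every right edge carries a segment; no top / left edge does.
cellOK : {n : ℕ} → Grid n → ℕ → ℕ → Bool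
cellOK {n} G i j =
  eqBool (eastE t) (if suc j ≡ᵇ n then true else westE (tileAt G i (suc j))) ∧
  (if j ≡ᵇ 0 then not (westE t) else true) ∧
  eqBool (southE t) (if suc i ≡ᵇ n then true else northE (tileAt G (suc i) j)) ∧
  (if i ≡ᵇ 0 then not (northE t) else true)
  where t = tileAt G i j

locallyValid : {n : ℕ} → Grid n → Bool
locallyValid {n} G = allB {n} λ i → allB {n} λ j → cellOK G (toℕ i) (toℕ j)

data Dir : Set where
  fromS fromW : Dir

trace : {n : ℕ} → Grid n → ℕ → ℕ → ℕ → Dir → List (ℕ × ℕ) →
        Maybe (ℕ × List (ℕ × ℕ))
trace G zero r c d acc = nothing
trace {n} G (suc f) r c d acc = step d (tileAt G r c)
  where
  goN′ : ℕ → List (ℕ × ℕ) → Maybe (ℕ × List (ℕ × ℕ))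
  goN′ zero a = nothing
  goN′ (suc r′) a = trace G f r′ c fromS a
  goN : List (ℕ × ℕ) → Maybe (ℕ × List (ℕ × ℕ))
  goN = goN′ r
  goE : List (ℕ × ℕ) → Maybe (ℕ × List (ℕ × ℕ))
  goE a = if suc c ≡ᵇ n then just (r , a) else trace G f r (suc c) fromW a
  step : Dir → Tile → Maybe (ℕ × List (ℕ × ℕ))
  step fromS vert = goN acc
  step fromS cross = goN ((r , c) ∷ acc)
  step fromS relb = goE acc
  step fromW hor = goE acc
  step fromW cross = goE ((r , c) ∷ acc)
  step fromW jelb = goN acc
  step _ _ = nothing

pipeFrom : {n : ℕ} → Grid n → ℕ → Maybe (ℕ × List (ℕ × ℕ))
pipeFrom {n} G j = trace G (2 * n + 2) (n ∸ 1) j fromS []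

crossesOf : {n : ℕ} → Grid n → ℕ → List (ℕ × ℕ)
crossesOf G j with pipeFrom G j
... | just (_ , l) = l
... | nothing = []

-- w_B = v : for every row i, the pipe from column v(i) exits at row i
hasPerm : {n : ℕ} → Grid n → Vec (Fin n) n → Bool
hasPerm G v = allB λ i → check (toℕ i) (pipeFrom G (toℕ (V.lookup v i)))
  where
  check : ℕ → Maybe (ℕ × List (ℕ × ℕ)) → Bool
  check i (just (r , _)) = r ≡ᵇ i
  check i nothing = false

crossCount : {n : ℕ} → Grid n → ℕ → ℕ → ℕ
crossCount G a b = length (filterᵇ (λ p → elemP p (crossesOf G b)) (crossesOf G a))

reducedB : {n : ℕ} → Grid n → Bool
reducedB {n} G = allB {n} λ a → allB {n} λ b →
  eqFin a b ∨ (crossCount G (toℕ a) (toℕ b) ≤ᵇ 1)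

isReducedBPDOf : {n : ℕ} → Vec (Fin n) n → Grid n → Bool
isReducedBPDOf v G = locallyValid G ∧ hasPerm G v ∧ reducedB G

countRowRelb : {n : ℕ} → Grid n → ℕ → ℕ
countRowRelb {n} G i = length (filterᵇ (λ (j : Fin n) → isRelb (tileAt G i (toℕ j))) (allFin n))

countColRelb : {n : ℕ} → Grid n → ℕ → ℕ
countColRelb {n} G j = length (filterᵇ (λ (i : Fin n) → isRelb (tileAt G (toℕ i) j)) (allFin n))

removable : {n : ℕ} → Grid n → Vec (Fin n) n → Fin n → Bool
removable G v i =
  isRelb (tileAt G (toℕ i) (toℕ (V.lookup v i))) ∧
  (countRowRelb G (toℕ i) ≡ᵇ 1) ∧ (countColRelb G (toℕ (V.lookup v i)) ≡ᵇ 1)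

minimalB : {n : ℕ} → Grid n → Vec (Fin n) n → Bool
minimalB G v = not (anyB (removable G v))

bpdCount : {n : ℕ} → Vec (Fin n) n → ℕ
bpdCount {n} v = length (filterᵇ (isReducedBPDOf v) (allGrids n))

mbpdCount : {m : ℕ} → Vec (Fin m) m → ℕ
mbpdCount {m} u = length (filterᵇ (λ G → isReducedBPDOf u G ∧ minimalB G u) (allGrids m))

rhsSum : {n : ℕ} → Vec (Fin n) n → ℕ
rhsSum {n} w = sum (map (λ m → sum (map (λ u →
    if containsB u w then mbpdCount u * patCount u w else 0) (perms m)))
  (upTo (suc n)))

-- A pipe j → i of a reduced bumpless pipe dream B of w is removable when its only r-elbow
-- sits at (i, j) and no other r-elbow shares its row or column.  Then the pipe is a hook:
-- left of the elbow its row holds only blanks and verticals, right of it only horizontals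
-- and crosses, and similarly in its column.  Deleting row i and column j therefore gives a
-- reduced BPD of the pattern of w with position i deleted, and B is recovered from the
-- smaller diagram and the pair (i, j).  Removing removable pipes (always the first one)
-- until none is left ends at a minimal BPD M of a pattern u of w, together with the
-- occurrence of u formed by the surviving positions, and B is recovered from M and that
-- occurrence.  So B ↦ (M, occurrence) is injective, which is the inequality.
module Submission where

open import Defs
open import Data.Bool using (Bool; true; false; not; _∧_; _∨_; if_then_else_; T?)
open import Data.Bool.Properties using (T-≡; ¬-not)
open import Data.Bool.ListAction using (and; or)
open import Data.Empty using (⊥; ⊥-elim)
open import Data.Fin using (Fin; toℕ; punchIn; punchOut; fromℕ<) renaming (zero to fz; suc to fs)
import Data.Fin.Properties as FP
open import Data.Fin.Permutation using (Permutation′; _⟨$⟩ʳ_; _⟨$⟩ˡ_; remove; inverseʳ; punchIn-permute)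
open import Data.List using (List; []; _∷_; _++_; map; mapMaybe; concatMap; length; filterᵇ; upTo; allFin; tabulate; cartesianProductWith)
import Data.List.Properties as LP
open import Data.List.Membership.Propositional using (_∈_)
open import Data.List.Membership.Propositional.Properties
  using (∈-++⁺ˡ; ∈-++⁺ʳ; ∈-map⁺; ∈-concatMap⁺; ∈-cartesianProductWith⁺; ∈-upTo⁺; ∈-allFin; ∈-length; ∈-filter⁺; ∈-filter⁻)
open import Data.List.Relation.Unary.All as All using (All; []; _∷_)
open import Data.List.Relation.Unary.Any as Any using (Any; here; there; _─_)
open import Data.List.Relation.Unary.AllPairs using ([]; _∷_)
open import Data.List.Relation.Unary.Unique.Propositional using (Unique)
import Data.List.Relation.Unary.Unique.Propositional.Properties as UP
open import Data.Maybe using (Maybe; just; nothing)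
open import Data.Maybe.Properties using (just-injective)
import Data.Maybe as M
open import Data.Nat using (ℕ; zero; suc; _+_; _*_; _∸_; _≡ᵇ_; _<ᵇ_; _≤ᵇ_; _≤_; _<_; z≤n; s≤s; pred; >-nonZero)
open import Data.Nat.Properties
open import Algebra.Properties.CommutativeSemigroup +-commutativeSemigroup using (x∙yz≈y∙xz)
open import Data.Nat.ListAction using (sum)
open import Data.Product using (_×_; _,_; Σ; ∃; proj₁; proj₂)
open import Data.Product.Properties using (,-injectiveˡ; ,-injectiveʳ)
open import Data.Sum using (_⊎_; inj₁; inj₂; [_,_]′)
open import Data.Unit using (⊤; tt)
open import Data.Vec as V using (Vec)
import Data.Vec.Properties as VP
open import Function using (_∘_; Equivalence)
open import Function.Bundles using (Injection)
open import Function.Properties.Inverse using (↔⇒↣)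
open import Relation.Binary.Definitions using (tri<; tri≈; tri>)
open import Relation.Binary.PropositionalEquality
open import Relation.Nullary using (yes; no; contradiction)

punchInℕ : ℕ → ℕ → ℕ
punchInℕ zero k = suc k
punchInℕ (suc a) zero = zero
punchInℕ (suc a) (suc k) = suc (punchInℕ a k)

-- Only meaningful for y ≢ a, like Data.Fin.punchOut.
punchOutℕ : ℕ → ℕ → ℕ
punchOutℕ zero y = pred y
punchOutℕ (suc a) zero = zero
punchOutℕ (suc a) (suc y) = suc (punchOutℕ a y)

punchOutℕ-punchInℕ : ∀ a k → punchOutℕ a (punchInℕ a k) ≡ k
punchOutℕ-punchInℕ zero k = refl
punchOutℕ-punchInℕ (suc a) zero = refl
punchOutℕ-punchInℕ (suc a) (suc k) = cong suc (punchOutℕ-punchInℕ a k)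

punchInℕ-punchOutℕ : ∀ a y → y ≢ a → punchInℕ a (punchOutℕ a y) ≡ y
punchInℕ-punchOutℕ zero zero ne = ⊥-elim (ne refl)
punchInℕ-punchOutℕ zero (suc y) ne = refl
punchInℕ-punchOutℕ (suc a) zero ne = refl
punchInℕ-punchOutℕ (suc a) (suc y) ne = cong suc (punchInℕ-punchOutℕ a y (ne ∘ cong suc))

punchInℕ≢ : ∀ a k → punchInℕ a k ≢ a
punchInℕ≢ zero k ()
punchInℕ≢ (suc a) zero ()
punchInℕ≢ (suc a) (suc k) e = punchInℕ≢ a k (suc-injective e)

punchInℕ-< : ∀ a k → k < a → punchInℕ a k ≡ k
punchInℕ-< (suc a) zero _ = refl
punchInℕ-< (suc a) (suc k) (s≤s k<a) = cong suc (punchInℕ-< a k k<a)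

punchInℕ-≥ : ∀ a k → a ≤ k → punchInℕ a k ≡ suc k
punchInℕ-≥ zero k _ = refl
punchInℕ-≥ (suc a) (suc k) (s≤s a≤k) = cong suc (punchInℕ-≥ a k a≤k)

punchInℕ-self : ∀ a → punchInℕ a a ≡ suc a
punchInℕ-self a = punchInℕ-≥ a a ≤-refl

punchInℕ-suc : ∀ a r → punchInℕ a (suc r) ≡ suc (punchInℕ a r) ⊎ (a ≡ suc r × punchInℕ a r ≡ r)
punchInℕ-suc zero r = inj₁ refl
punchInℕ-suc (suc zero) zero = inj₂ (refl , refl)
punchInℕ-suc (suc (suc a)) zero = inj₁ refl
punchInℕ-suc (suc a) (suc r) with punchInℕ-suc a r
... | inj₁ e = inj₁ (cong suc e)
... | inj₂ (e , e′) = inj₂ (cong suc e , cong suc e′)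

punchInℕ-zero : ∀ a → (a ≡ 0 × punchInℕ a 0 ≡ 1) ⊎ punchInℕ a 0 ≡ 0
punchInℕ-zero zero = inj₁ (refl , refl)
punchInℕ-zero (suc a) = inj₂ refl

punchInℕ-<ᵇ : ∀ a x y → (punchInℕ a x <ᵇ punchInℕ a y) ≡ (x <ᵇ y)
punchInℕ-<ᵇ zero x y = refl
punchInℕ-<ᵇ (suc a) zero zero = refl
punchInℕ-<ᵇ (suc a) zero (suc y) = refl
punchInℕ-<ᵇ (suc a) (suc x) zero = refl
punchInℕ-<ᵇ (suc a) (suc x) (suc y) = punchInℕ-<ᵇ a x y

punchInℕ≤suc : ∀ a k → punchInℕ a k ≤ suc k
punchInℕ≤suc zero k = ≤-refl
punchInℕ≤suc (suc a) zero = z≤n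
punchInℕ≤suc (suc a) (suc k) = s≤s (punchInℕ≤suc a k)

punchInℕ-≤ : ∀ a k n → a ≤ n → k < n → punchInℕ a k ≤ n
punchInℕ-≤ zero k n _ k<n = k<n
punchInℕ-≤ (suc a) zero n _ _ = z≤n
punchInℕ-≤ (suc a) (suc k) (suc n) (s≤s a≤n) (s≤s k<n) = s≤s (punchInℕ-≤ a k n a≤n k<n)

punchOutℕ-< : ∀ a y n → a ≤ n → y ≤ n → y ≢ a → punchOutℕ a y < n
punchOutℕ-< zero zero n _ _ ne = ⊥-elim (ne refl)
punchOutℕ-< zero (suc y) n _ y≤n _ = y≤n
punchOutℕ-< (suc a) zero (suc n) _ _ _ = s≤s z≤n
punchOutℕ-< (suc a) (suc y) (suc n) (s≤s a≤n) (s≤s y≤n) ne = s≤s (punchOutℕ-< a y n a≤n y≤n (ne ∘ cong suc))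

toℕ-punchIn : ∀ {n} (i : Fin (suc n)) (j : Fin n) → toℕ (punchIn i j) ≡ punchInℕ (toℕ i) (toℕ j)
toℕ-punchIn fz j = refl
toℕ-punchIn (fs i) fz = refl
toℕ-punchIn (fs i) (fs j) = cong suc (toℕ-punchIn i j)

perm-injective : ∀ {m} (w : Permutation′ m) {a b} → w ⟨$⟩ʳ a ≡ w ⟨$⟩ʳ b → a ≡ b
perm-injective w = Injection.injective (↔⇒↣ w)

toℕ-≤-pred : ∀ {m} (i : Fin (suc m)) → toℕ i ≤ m
toℕ-≤-pred i = ≤-pred (FP.toℕ<n i)

toℕ-remove : ∀ {m} (w : Permutation′ (suc m)) i k →
             punchInℕ (toℕ (w ⟨$⟩ʳ i)) (toℕ (remove i w ⟨$⟩ʳ k)) ≡ toℕ (w ⟨$⟩ʳ punchIn i k)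
toℕ-remove w i k = trans (sym (toℕ-punchIn _ _)) (cong toℕ (sym (punchIn-permute w i k)))

≡ᵇ-sound : ∀ {m n} → (m ≡ᵇ n) ≡ true → m ≡ n
≡ᵇ-sound {m} {n} h = ≡ᵇ⇒≡ m n (Equivalence.from T-≡ h)

≡ᵇ-refl : ∀ n → (n ≡ᵇ n) ≡ true
≡ᵇ-refl n = Equivalence.to T-≡ (≡⇒≡ᵇ n n refl)

≡ᵇ-complete : ∀ {m n} → m ≡ n → (m ≡ᵇ n) ≡ true
≡ᵇ-complete {m} refl = ≡ᵇ-refl m

≢⇒≡ᵇ-false : ∀ {m n} → m ≢ n → (m ≡ᵇ n) ≡ false
≢⇒≡ᵇ-false ne = ¬-not (ne ∘ ≡ᵇ-sound)

≡ᵇ-false⇒≢ : ∀ {m n} → (m ≡ᵇ n) ≡ false → m ≢ n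
≡ᵇ-false⇒≢ h e = contradiction (trans (sym h) (≡ᵇ-complete e)) λ ()

<ᵇ-sound : ∀ {m n} → (m <ᵇ n) ≡ true → m < n
<ᵇ-sound {m} {n} h = <ᵇ⇒< m n (Equivalence.from T-≡ h)

<ᵇ-complete : ∀ {m n} → m < n → (m <ᵇ n) ≡ true
<ᵇ-complete lt = Equivalence.to T-≡ (<⇒<ᵇ lt)

≥⇒<ᵇ-false : ∀ {m n} → n ≤ m → (m <ᵇ n) ≡ false
≥⇒<ᵇ-false n≤m = ¬-not (λ h → <⇒≱ (<ᵇ-sound h) n≤m)

≤ᵇ-sound : ∀ {m n} → (m ≤ᵇ n) ≡ true → m ≤ n
≤ᵇ-sound {m} {n} h = ≤ᵇ⇒≤ m n (Equivalence.from T-≡ h)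

≤ᵇ-complete : ∀ {m n} → m ≤ n → (m ≤ᵇ n) ≡ true
≤ᵇ-complete le = Equivalence.to T-≡ (≤⇒≤ᵇ le)

∧-true⁻ : ∀ {a b} → a ∧ b ≡ true → a ≡ true × b ≡ true
∧-true⁻ {true} {true} _ = refl , refl

∧-true : ∀ {a b} → a ≡ true → b ≡ true → a ∧ b ≡ true
∧-true refl refl = refl

∨-trueʳ : ∀ a {b} → b ≡ true → a ∨ b ≡ true
∨-trueʳ true _ = refl
∨-trueʳ false h = h

eqBool-sound : ∀ a b → eqBool a b ≡ true → a ≡ b
eqBool-sound true true _ = refl
eqBool-sound false false _ = refl

eqBool-complete : ∀ a b → a ≡ b → eqBool a b ≡ true
eqBool-complete true .true refl = refl
eqBool-complete false .false refl = refl

trichotomy : ∀ a b → a < b ⊎ a ≡ b ⊎ b < a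
trichotomy a b with <-cmp a b
... | tri< lt _ _ = inj₁ lt
... | tri≈ _ eq _ = inj₂ (inj₁ eq)
... | tri> _ _ gt = inj₂ (inj₂ gt)

-- Grids as functions of (row, column), as read by tileAt; deleting row i and column j
-- is then precomposition with punchInℕ i and punchInℕ j.
Tiling : Set
Tiling = ℕ → ℕ → Tile

_≗₂_ : Tiling → Tiling → Set
F ≗₂ G = ∀ r c → F r c ≡ G r c

-- cellOK G of Defs is definitionally cellOKᶠ n (tileAt G).
eastOK westOK southOK northOK cellOKᶠ : ℕ → Tiling → ℕ → ℕ → Bool
eastOK n F i j = eqBool (eastE (F i j)) (if suc j ≡ᵇ n then true else westE (F i (suc j)))
westOK n F i j = if j ≡ᵇ 0 then not (westE (F i j)) else true
southOK n F i j = eqBool (southE (F i j)) (if suc i ≡ᵇ n then true else northE (F (suc i) j))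
northOK n F i j = if i ≡ᵇ 0 then not (northE (F i j)) else true
cellOKᶠ n F i j = eastOK n F i j ∧ westOK n F i j ∧ southOK n F i j ∧ northOK n F i j

cellOKᶠ-cong : ∀ n {F G} → F ≗₂ G → ∀ r c → cellOKᶠ n F r c ≡ cellOKᶠ n G r c
cellOKᶠ-cong n F≗G r c rewrite F≗G r c | F≗G r (suc c) | F≗G (suc r) c = refl

Trace : Set
Trace = Maybe (ℕ × List (ℕ × ℕ))

data Heading : Set where
  north east : Heading

leave : Dir → Tile → Maybe Heading
leave fromS vert = just north
leave fromS cross = just north
leave fromS relb = just east
leave fromW hor = just east
leave fromW cross = just east
leave fromW jelb = just north
leave _ _ = nothing

noteCross : Tile → ℕ → ℕ → List (ℕ × ℕ) → List (ℕ × ℕ)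
noteCross cross r c acc = (r , c) ∷ acc
noteCross _ r c acc = acc

-- Defs.trace with the tile deciding only where the pipe leaves and crosses recorded uniformly.
mutual
  traceᶠ : ℕ → Tiling → ℕ → ℕ → ℕ → Dir → List (ℕ × ℕ) → Trace
  traceᶠ n F zero r c d acc = nothing
  traceᶠ n F (suc f) r c d acc = move n F f r c (leave d (F r c)) (noteCross (F r c) r c acc)

  move : ℕ → Tiling → ℕ → ℕ → ℕ → Maybe Heading → List (ℕ × ℕ) → Trace
  move n F f r c nothing acc = nothing
  move n F f r c (just north) acc = goNorth n F f r c acc
  move n F f r c (just east) acc = goEast n F f r c acc

  goNorth : ℕ → Tiling → ℕ → ℕ → ℕ → List (ℕ × ℕ) → Trace
  goNorth n F f zero c acc = nothing
  goNorth n F f (suc r) c acc = traceᶠ n F f r c fromS acc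

  goEast : ℕ → Tiling → ℕ → ℕ → ℕ → List (ℕ × ℕ) → Trace
  goEast n F f r c acc = if suc c ≡ᵇ n then just (r , acc) else traceᶠ n F f r (suc c) fromW acc

trace≡traceᶠ : ∀ {n} (G : Grid n) f r c d acc → trace G f r c d acc ≡ traceᶠ n (tileAt G) f r c d acc
trace≡traceᶠ G zero r c d acc = refl
trace≡traceᶠ {n} G (suc f) r c d acc with tileAt G r c
trace≡traceᶠ G (suc f) zero c fromS acc | vert = refl
trace≡traceᶠ G (suc f) (suc r) c fromS acc | vert = trace≡traceᶠ G f r c fromS acc
trace≡traceᶠ G (suc f) zero c fromS acc | cross = refl
trace≡traceᶠ G (suc f) (suc r) c fromS acc | cross = trace≡traceᶠ G f r c fromS _
trace≡traceᶠ G (suc f) zero c fromW acc | jelb = refl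
trace≡traceᶠ G (suc f) (suc r) c fromW acc | jelb = trace≡traceᶠ G f r c fromS acc
trace≡traceᶠ {n} G (suc f) r c fromS acc | relb =
  cong (if suc c ≡ᵇ n then just (r , acc) else_) (trace≡traceᶠ G f r (suc c) fromW acc)
trace≡traceᶠ {n} G (suc f) r c fromW acc | hor =
  cong (if suc c ≡ᵇ n then just (r , acc) else_) (trace≡traceᶠ G f r (suc c) fromW acc)
trace≡traceᶠ {n} G (suc f) r c fromW acc | cross =
  cong (if suc c ≡ᵇ n then just (r , _) else_) (trace≡traceᶠ G f r (suc c) fromW _)
trace≡traceᶠ G (suc f) r c fromS acc | blank = refl
trace≡traceᶠ G (suc f) r c fromS acc | hor = refl
trace≡traceᶠ G (suc f) r c fromS acc | jelb = refl
trace≡traceᶠ G (suc f) r c fromW acc | blank = refl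
trace≡traceᶠ G (suc f) r c fromW acc | vert = refl
trace≡traceᶠ G (suc f) r c fromW acc | relb = refl

module _ (n : ℕ) {F G : Tiling} (F≗G : F ≗₂ G) where
  mutual
    traceᶠ-cong : ∀ f r c d acc → traceᶠ n F f r c d acc ≡ traceᶠ n G f r c d acc
    traceᶠ-cong zero r c d acc = refl
    traceᶠ-cong (suc f) r c d acc rewrite F≗G r c = move-cong f r c (leave d (G r c)) _

    move-cong : ∀ f r c h acc → move n F f r c h acc ≡ move n G f r c h acc
    move-cong f r c nothing acc = refl
    move-cong f zero c (just north) acc = refl
    move-cong f (suc r) c (just north) acc = traceᶠ-cong f r c fromS acc
    move-cong f r c (just east) acc =
      cong (if suc c ≡ᵇ n then just (r , acc) else_) (traceᶠ-cong f r (suc c) fromW acc)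

pipeᶠ : ℕ → Tiling → ℕ → Trace
pipeᶠ n F j = traceᶠ n F (2 * n + 2) (n ∸ 1) j fromS []

crossesᶠ : ℕ → Tiling → ℕ → List (ℕ × ℕ)
crossesᶠ n F j = M.maybe proj₂ [] (pipeᶠ n F j)

crossCountᶠ : ℕ → Tiling → ℕ → ℕ → ℕ
crossCountᶠ n F a b = length (filterᵇ (λ p → elemP p (crossesᶠ n F b)) (crossesᶠ n F a))

pipeFrom≡pipeᶠ : ∀ {n} (G : Grid n) j → pipeFrom G j ≡ pipeᶠ n (tileAt G) j
pipeFrom≡pipeᶠ {n} G j = trace≡traceᶠ G (2 * n + 2) (n ∸ 1) j fromS []

pipeᶠ-cong : ∀ n {F G} → F ≗₂ G → ∀ j → pipeᶠ n F j ≡ pipeᶠ n G j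
pipeᶠ-cong n F≗G j = traceᶠ-cong n F≗G (2 * n + 2) (n ∸ 1) j fromS []

crossesOf≡crossesᶠ : ∀ {n} (G : Grid n) j → crossesOf G j ≡ crossesᶠ n (tileAt G) j
crossesOf≡crossesᶠ G j = trans crossesOf-maybe (cong (M.maybe proj₂ []) (pipeFrom≡pipeᶠ G j))
  where
  crossesOf-maybe : crossesOf G j ≡ M.maybe proj₂ [] (pipeFrom G j)
  crossesOf-maybe with pipeFrom G j
  ... | just _ = refl
  ... | nothing = refl

crossCount≡crossCountᶠ : ∀ {n} (G : Grid n) a b → crossCount G a b ≡ crossCountᶠ n (tileAt G) a b
crossCount≡crossCountᶠ G a b rewrite crossesOf≡crossesᶠ G a | crossesOf≡crossesᶠ G b = refl

crossCountᶠ-cong : ∀ n {F G} → F ≗₂ G → ∀ a b → crossCountᶠ n F a b ≡ crossCountᶠ n G a b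
crossCountᶠ-cong n F≗G a b rewrite pipeᶠ-cong n F≗G a | pipeᶠ-cong n F≗G b = refl

boolToℕ : Bool → ℕ
boolToℕ true = 1
boolToℕ false = 0

count : ℕ → (ℕ → Bool) → ℕ
count zero p = 0
count (suc n) p = boolToℕ (p 0) + count n (p ∘ suc)

length-filter-tabulate : ∀ {A : Set} n (p : ℕ → Bool) (g : Fin n → A) (q : A → Bool) →
                         (∀ k → q (g k) ≡ p (toℕ k)) → length (filterᵇ q (tabulate g)) ≡ count n p
length-filter-tabulate zero p g q h = refl
length-filter-tabulate (suc n) p g q h rewrite h fz with p 0
... | true = cong suc (length-filter-tabulate n (p ∘ suc) (g ∘ fs) q (h ∘ fs))
... | false = length-filter-tabulate n (p ∘ suc) (g ∘ fs) q (h ∘ fs)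

count-punchIn : ∀ n p j → j ≤ n → count (suc n) p ≡ boolToℕ (p j) + count n (p ∘ punchInℕ j)
count-punchIn n p zero _ = refl
count-punchIn (suc n) p (suc j) (s≤s j≤n) = begin
  boolToℕ (p 0) + count (suc n) (p ∘ suc)
    ≡⟨ cong (boolToℕ (p 0) +_) (count-punchIn n (p ∘ suc) j j≤n) ⟩
  boolToℕ (p 0) + (boolToℕ (p (suc j)) + count n (p ∘ suc ∘ punchInℕ j))
    ≡⟨ x∙yz≈y∙xz (boolToℕ (p 0)) (boolToℕ (p (suc j))) _ ⟩
  boolToℕ (p (suc j)) + (boolToℕ (p 0) + count n (p ∘ suc ∘ punchInℕ j)) ∎
  where open ≡-Reasoning

count≡0 : ∀ n p → count n p ≡ 0 → ∀ c → c < n → p c ≡ false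
count≡0 (suc n) p h c c<n with p 0 in p0
count≡0 (suc n) p h zero c<n | false = p0
count≡0 (suc n) p h (suc c) (s≤s c<n) | false = count≡0 n (p ∘ suc) h c c<n

count-cong : ∀ n p q → (∀ c → c < n → p c ≡ q c) → count n p ≡ count n q
count-cong zero p q h = refl
count-cong (suc n) p q h = cong₂ _+_ (cong boolToℕ (h 0 (s≤s z≤n))) (count-cong n _ _ (λ c c<n → h (suc c) (s≤s c<n)))

countRowᶠ countColᶠ : ℕ → Tiling → ℕ → ℕ
countRowᶠ n F i = count n (λ j → isRelb (F i j))
countColᶠ n F j = count n (λ i → isRelb (F i j))

removableᶠ : (n : ℕ) → Tiling → (Fin n → Fin n) → Fin n → Bool
removableᶠ n F w i = isRelb (F (toℕ i) (toℕ (w i))) ∧ (countRowᶠ n F (toℕ i) ≡ᵇ 1) ∧ (countColᶠ n F (toℕ (w i)) ≡ᵇ 1)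

removable≡removableᶠ : ∀ {n} (G : Grid n) v i → removable G v i ≡ removableᶠ n (tileAt G) (V.lookup v) i
removable≡removableᶠ {n} G v i = cong₂ (λ x y → isRelb (tileAt G (toℕ i) (toℕ (V.lookup v i))) ∧ (x ≡ᵇ 1) ∧ (y ≡ᵇ 1))
  (length-filter-tabulate n _ (λ k → k) _ (λ _ → refl)) (length-filter-tabulate n _ (λ k → k) _ (λ _ → refl))

removableᶠ-cong : ∀ n {F G} → F ≗₂ G → (p q : Fin n → Fin n) → (∀ k → p k ≡ q k) →
                  ∀ k → removableᶠ n F p k ≡ removableᶠ n G q k
removableᶠ-cong n {F} {G} F≗G p q p≗q k rewrite p≗q k | F≗G (toℕ k) (toℕ (q k)) =
  cong₂ (λ x y → isRelb (G (toℕ k) (toℕ (q k))) ∧ (x ≡ᵇ 1) ∧ (y ≡ᵇ 1))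
    (count-cong n _ _ (λ c _ → cong isRelb (F≗G (toℕ k) c))) (count-cong n _ _ (λ r _ → cong isRelb (F≗G r (toℕ (q k)))))

and-map-tabulate⁻ : ∀ {A : Set} n (g : Fin n → A) (p : A → Bool) → and (map p (tabulate g)) ≡ true → ∀ i → p (g i) ≡ true
and-map-tabulate⁻ (suc n) g p h i with p (g fz) in pg0
and-map-tabulate⁻ (suc n) g p h fz | true = pg0
and-map-tabulate⁻ (suc n) g p h (fs i) | true = and-map-tabulate⁻ n (g ∘ fs) p h i

and-map-tabulate⁺ : ∀ {A : Set} n (g : Fin n → A) (p : A → Bool) → (∀ i → p (g i) ≡ true) → and (map p (tabulate g)) ≡ true
and-map-tabulate⁺ zero g p h = refl
and-map-tabulate⁺ (suc n) g p h rewrite h fz = and-map-tabulate⁺ n (g ∘ fs) p (h ∘ fs)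

or-map-tabulate⁺ : ∀ {A : Set} n (g : Fin n → A) (p : A → Bool) → (∀ i → p (g i) ≡ false) → or (map p (tabulate g)) ≡ false
or-map-tabulate⁺ zero g p h = refl
or-map-tabulate⁺ (suc n) g p h rewrite h fz = or-map-tabulate⁺ n (g ∘ fs) p (h ∘ fs)

allB⁻ : ∀ {n} (p : Fin n → Bool) → allB p ≡ true → ∀ i → p i ≡ true
allB⁻ {n} p = and-map-tabulate⁻ n (λ k → k) p

and-map-tabulate-false : ∀ {A : Set} n (g : Fin n → A) (p : A → Bool) → and (map p (tabulate g)) ≡ false → ∃ λ i → p (g i) ≡ false
and-map-tabulate-false (suc n) g p h with p (g fz) in pg0
... | false = fz , pg0
... | true with and-map-tabulate-false n (g ∘ fs) p h
...   | i , pgi = fs i , pgi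

allB-false : ∀ {n} (p : Fin n → Bool) → allB p ≡ false → ∃ λ i → p i ≡ false
allB-false {n} p = and-map-tabulate-false n (λ k → k) p

allB⁺ : ∀ {n} (p : Fin n → Bool) → (∀ i → p i ≡ true) → allB p ≡ true
allB⁺ {n} p = and-map-tabulate⁺ n (λ k → k) p

anyB-false : ∀ {n} (p : Fin n → Bool) → (∀ i → p i ≡ false) → anyB p ≡ false
anyB-false {n} p = or-map-tabulate⁺ n (λ k → k) p

BlankOutside : ℕ → Tiling → Set
BlankOutside n F = ∀ r c → n ≤ r ⊎ n ≤ c → F r c ≡ blank

LocallyValid : ℕ → Tiling → Set
LocallyValid n F = ∀ r c → r < n → c < n → cellOKᶠ n F r c ≡ true

Realises : (n : ℕ) → Tiling → (Fin n → Fin n) → Set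
Realises n F w = ∀ k → ∃ λ l → pipeᶠ n F (toℕ (w k)) ≡ just (toℕ k , l)

Reduced : ℕ → Tiling → Set
Reduced n F = ∀ (a b : Fin n) → a ≢ b → crossCountᶠ n F (toℕ a) (toℕ b) ≤ 1

Minimal : (n : ℕ) → Tiling → (Fin n → Fin n) → Set
Minimal n F w = ∀ k → removableᶠ n F w k ≡ false

record Edges (n : ℕ) (F : Tiling) : Set where
  field
    east-west : ∀ r c → r < n → suc c < n → eastE (F r c) ≡ westE (F r (suc c))
    east-boundary : ∀ r c → r < n → suc c ≡ n → eastE (F r c) ≡ true
    west-boundary : ∀ r → r < n → westE (F r 0) ≡ false
    south-north : ∀ r c → suc r < n → c < n → southE (F r c) ≡ northE (F (suc r) c)
    south-boundary : ∀ r c → suc r ≡ n → c < n → southE (F r c) ≡ true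
    north-boundary : ∀ c → c < n → northE (F 0 c) ≡ false

module _ (n : ℕ) (F : Tiling) where
  cellOKᶠ⁻ : ∀ r c → cellOKᶠ n F r c ≡ true →
             eastOK n F r c ≡ true × westOK n F r c ≡ true × southOK n F r c ≡ true × northOK n F r c ≡ true
  cellOKᶠ⁻ r c h with eastOK n F r c | westOK n F r c | southOK n F r c | northOK n F r c
  ... | true | true | true | true = refl , refl , refl , refl

  locallyValid⇒edges : LocallyValid n F → Edges n F
  locallyValid⇒edges lv = record
    { east-west = λ r c r<n c+1<n → eastOK-inner r c (<⇒≢ c+1<n) (proj₁ (cell r c r<n (<-trans (n<1+n c) c+1<n)))
    ; east-boundary = λ r c r<n c+1≡n → eastOK-last r c c+1≡n (proj₁ (cell r c r<n (subst (c <_) c+1≡n (n<1+n c))))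
    ; west-boundary = λ r r<n → westOK-first r (proj₁ (proj₂ (cell r 0 r<n (≤-<-trans z≤n r<n))))
    ; south-north = λ r c r+1<n c<n → southOK-inner r c (<⇒≢ r+1<n) (proj₁ (proj₂ (proj₂ (cell r c (<-trans (n<1+n r) r+1<n) c<n))))
    ; south-boundary = λ r c r+1≡n c<n → southOK-last r c r+1≡n (proj₁ (proj₂ (proj₂ (cell r c (subst (r <_) r+1≡n (n<1+n r)) c<n))))
    ; north-boundary = λ c c<n → northOK-first c (proj₂ (proj₂ (proj₂ (cell 0 c (≤-<-trans z≤n c<n) c<n))))
    }
    where
    cell : ∀ r c → r < n → c < n →
           eastOK n F r c ≡ true × westOK n F r c ≡ true × southOK n F r c ≡ true × northOK n F r c ≡ true
    cell r c r<n c<n = cellOKᶠ⁻ r c (lv r c r<n c<n)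
    eastOK-inner : ∀ r c → suc c ≢ n → eastOK n F r c ≡ true → eastE (F r c) ≡ westE (F r (suc c))
    eastOK-inner r c ne rewrite ≢⇒≡ᵇ-false ne = eqBool-sound _ _
    eastOK-last : ∀ r c → suc c ≡ n → eastOK n F r c ≡ true → eastE (F r c) ≡ true
    eastOK-last r c e rewrite ≡ᵇ-complete e = eqBool-sound _ _
    southOK-inner : ∀ r c → suc r ≢ n → southOK n F r c ≡ true → southE (F r c) ≡ northE (F (suc r) c)
    southOK-inner r c ne rewrite ≢⇒≡ᵇ-false ne = eqBool-sound _ _
    southOK-last : ∀ r c → suc r ≡ n → southOK n F r c ≡ true → southE (F r c) ≡ true
    southOK-last r c e rewrite ≡ᵇ-complete e = eqBool-sound _ _
    westOK-first : ∀ r → westOK n F r 0 ≡ true → westE (F r 0) ≡ false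
    westOK-first r with westE (F r 0)
    ... | false = λ _ → refl
    northOK-first : ∀ c → northOK n F 0 c ≡ true → northE (F 0 c) ≡ false
    northOK-first c with northE (F 0 c)
    ... | false = λ _ → refl

  edges⇒locallyValid : Edges n F → LocallyValid n F
  edges⇒locallyValid ed r c r<n c<n = ∧-true east-ok (∧-true (west-ok c) (∧-true south-ok (north-ok r)))
    where
    open Edges ed
    east-ok : eastOK n F r c ≡ true
    east-ok with suc c ≡ᵇ n in e
    ... | true = eqBool-complete _ _ (east-boundary r c r<n (≡ᵇ-sound e))
    ... | false = eqBool-complete _ _ (east-west r c r<n (≤∧≢⇒< c<n (≡ᵇ-false⇒≢ e)))
    west-ok : ∀ c → westOK n F r c ≡ true
    west-ok zero rewrite west-boundary r r<n = refl
    west-ok (suc _) = refl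
    south-ok : southOK n F r c ≡ true
    south-ok with suc r ≡ᵇ n in e
    ... | true = eqBool-complete _ _ (south-boundary r c (≡ᵇ-sound e) c<n)
    ... | false = eqBool-complete _ _ (south-north r c (≤∧≢⇒< r<n (≡ᵇ-false⇒≢ e)) c<n)
    north-ok : ∀ r → northOK n F r c ≡ true
    north-ok zero rewrite north-boundary c c<n = refl
    north-ok (suc _) = refl

∸-suc : ∀ n c → c < n → n ∸ c ≡ suc (n ∸ suc c)
∸-suc (suc n) zero _ = refl
∸-suc (suc n) (suc c) (s≤s c<n) = ∸-suc n c c<n

-- Fuel r + (n ∸ c) suffices: each step moves one row up or one column right.
module _ (n : ℕ) (F : Tiling) {res : ℕ × List (ℕ × ℕ)} where
  mutual
    traceᶠ-fuel : ∀ f r c d acc → c < n → traceᶠ n F f r c d acc ≡ just res →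
                  ∀ f′ → r + (n ∸ c) ≤ f′ → traceᶠ n F f′ r c d acc ≡ just res
    traceᶠ-fuel (suc f) r c d acc c<n h zero le =
      contradiction (≤-trans (≤-reflexive (sym (∸-suc n c c<n))) (≤-trans (m≤n+m (n ∸ c) r) le)) λ ()
    traceᶠ-fuel (suc f) r c d acc c<n h (suc f′) le = move-fuel f f′ r c (leave d (F r c)) _ c<n h le

    move-fuel : ∀ f f′ r c m acc → c < n → move n F f r c m acc ≡ just res →
                r + (n ∸ c) ≤ suc f′ → move n F f′ r c m acc ≡ just res
    move-fuel f f′ (suc r) c (just north) acc c<n h (s≤s le) = traceᶠ-fuel f r c fromS acc c<n h f′ le
    move-fuel f f′ r c (just east) acc c<n h le with suc c ≡ᵇ n in e
    ... | true = h
    ... | false = traceᶠ-fuel f r (suc c) fromW acc (≤∧≢⇒< c<n (≡ᵇ-false⇒≢ e)) h f′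
                    (≤-pred (≤-trans (≤-reflexive (trans (sym (+-suc r _)) (cong (r +_) (sym (∸-suc n c c<n))))) le))

straight : Tile → Bool
straight relb = false
straight jelb = false
straight _ = true

straight⇒west≡east : ∀ t → straight t ≡ true → westE t ≡ eastE t
straight⇒west≡east blank _ = refl
straight⇒west≡east hor _ = refl
straight⇒west≡east vert _ = refl
straight⇒west≡east cross _ = refl

straight⇒north≡south : ∀ t → straight t ≡ true → northE t ≡ southE t
straight⇒north≡south blank _ = refl
straight⇒north≡south hor _ = refl
straight⇒north≡south vert _ = refl
straight⇒north≡south cross _ = refl

module _ {n : ℕ} {F : Tiling} {f r c : ℕ} {acc : List (ℕ × ℕ)} {res : ℕ × List (ℕ × ℕ)} where
  straight-north : ∀ t → straight t ≡ true → move n F f r c (leave fromS t) acc ≡ just res → goNorth n F f r c acc ≡ just res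
  straight-north vert _ h = h
  straight-north cross _ h = h

  straight-east : ∀ t → straight t ≡ true → move n F f r c (leave fromW t) acc ≡ just res → goEast n F f r c acc ≡ just res
  straight-east hor _ h = h
  straight-east cross _ h = h

module _ {n : ℕ} {F : Tiling} {f : ℕ} {acc : List (ℕ × ℕ)} {res : ℕ × List (ℕ × ℕ)} where
  goNorth-just : ∀ r {c} → goNorth n F f r c acc ≡ just res → ∃ λ r′ → suc r′ ≡ r × traceᶠ n F f r′ c fromS acc ≡ just res
  goNorth-just (suc r′) h = r′ , refl , h

  goEast-inner : ∀ {r c} → suc c ≢ n → goEast n F f r c acc ≡ just res → traceᶠ n F f r (suc c) fromW acc ≡ just res
  goEast-inner {r} {c} ne rewrite ≢⇒≡ᵇ-false ne = λ h → h

  goEast-last : ∀ {r c} → suc c ≡ n → goEast n F f r c acc ≡ just res → just (r , acc) ≡ just res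
  goEast-last {r} {c} e rewrite ≡ᵇ-complete e = λ h → h

OneOf : Tile → Tile → Tile → Set
OneOf a b t = t ≡ a ⊎ t ≡ b

oneOf-elim : ∀ {a b t} (P : Tile → Set) → P a → P b → OneOf a b t → P t
oneOf-elim P pa pb (inj₁ refl) = pa
oneOf-elim P pa pb (inj₂ refl) = pb

noWest⇒blank⊎vert : ∀ t → westE t ≡ false → isRelb t ≡ false → OneOf blank vert t
noWest⇒blank⊎vert blank _ _ = inj₁ refl
noWest⇒blank⊎vert vert _ _ = inj₂ refl

east⇒hor⊎cross : ∀ t → eastE t ≡ true → isRelb t ≡ false → OneOf hor cross t
east⇒hor⊎cross hor _ _ = inj₁ refl
east⇒hor⊎cross cross _ _ = inj₂ refl

noNorth⇒blank⊎hor : ∀ t → northE t ≡ false → isRelb t ≡ false → OneOf blank hor t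
noNorth⇒blank⊎hor blank _ _ = inj₁ refl
noNorth⇒blank⊎hor hor _ _ = inj₂ refl

south⇒vert⊎cross : ∀ t → southE t ≡ true → isRelb t ≡ false → OneOf vert cross t
south⇒vert⊎cross vert _ _ = inj₁ refl
south⇒vert⊎cross cross _ _ = inj₂ refl

-- A tile of the tiling with a hook inserted is either fixed or read off one tile of
-- the smaller tiling; this makes congruence of the insertion a one-cell argument.
data Source : Set where
  fixed : Tile → Source
  copy : ℕ → ℕ → Source
  byNorth byWest : ℕ → ℕ → Tile → Tile → Source

resolve : Source → Tiling → Tile
resolve (fixed t) F = t
resolve (copy a b) F = F a b
resolve (byNorth a b t t′) F = if northE (F a b) then t else t′
resolve (byWest a b t t′) F = if westE (F a b) then t else t′

-- The hook of a pipe j → i inserted into a tiling of size n: an r-elbow at (i, j); in its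
-- row a vertical (left) or cross (right) wherever a pipe arrives from below, in its column
-- a horizontal (above) or cross (below) wherever a pipe arrives from the left.
hookSource : ℕ → ℕ → ℕ → ℕ → ℕ → Source
hookSource n i j r c =
  if r ≡ᵇ i then
    (if c ≡ᵇ j then fixed relb
     else if c <ᵇ j then fromBelow vert blank else fromBelow cross hor)
  else if c ≡ᵇ j then
    (if r <ᵇ i then fromLeft hor blank else fromLeft cross vert)
  else copy (punchOutℕ i r) (punchOutℕ j c)
  where
  fromBelow fromLeft : Tile → Tile → Source
  fromBelow t t′ = if i ≡ᵇ n then fixed t else byNorth i (punchOutℕ j c) t t′
  fromLeft t t′ = if j ≡ᵇ n then fixed t else byWest (punchOutℕ i r) j t t′

insertHook : ℕ → ℕ → ℕ → Tiling → Tiling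
insertHook n i j F r c = resolve (hookSource n i j r c) F

SourceWithin : ℕ → Source → Set
SourceWithin n (fixed _) = ⊤
SourceWithin n (copy a b) = a < n × b < n
SourceWithin n (byNorth a b _ _) = a < n × b < n
SourceWithin n (byWest a b _ _) = a < n × b < n

resolve-congWithin : ∀ n s {F G} → (∀ a b → a < n → b < n → F a b ≡ G a b) → SourceWithin n s → resolve s F ≡ resolve s G
resolve-congWithin n (fixed t) h _ = refl
resolve-congWithin n (copy a b) h (a<n , b<n) = h a b a<n b<n
resolve-congWithin n (byNorth a b _ _) h (a<n , b<n) rewrite h a b a<n b<n = refl
resolve-congWithin n (byWest a b _ _) h (a<n , b<n) rewrite h a b a<n b<n = refl

resolve-cong : ∀ s {F G} → F ≗₂ G → resolve s F ≡ resolve s G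
resolve-cong (fixed t) h = refl
resolve-cong (copy a b) h = h a b
resolve-cong (byNorth a b _ _) h rewrite h a b = refl
resolve-cong (byWest a b _ _) h rewrite h a b = refl

hookSource-within : ∀ n i j r c → i ≤ n → j ≤ n → r ≤ n → c ≤ n → SourceWithin n (hookSource n i j r c)
hookSource-within n i j r c i≤n j≤n r≤n c≤n with r ≡ᵇ i in r≟i | c ≡ᵇ j in c≟j
... | true | true = tt
... | true | false with c <ᵇ j | i ≡ᵇ n in i≟n
...   | true | true = tt
...   | false | true = tt
...   | true | false = ≤∧≢⇒< i≤n (≡ᵇ-false⇒≢ i≟n) , punchOutℕ-< j c n j≤n c≤n (≡ᵇ-false⇒≢ c≟j)
...   | false | false = ≤∧≢⇒< i≤n (≡ᵇ-false⇒≢ i≟n) , punchOutℕ-< j c n j≤n c≤n (≡ᵇ-false⇒≢ c≟j)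
hookSource-within n i j r c i≤n j≤n r≤n c≤n | false | true with r <ᵇ i | j ≡ᵇ n in j≟n
...   | true | true = tt
...   | false | true = tt
...   | true | false = punchOutℕ-< i r n i≤n r≤n (≡ᵇ-false⇒≢ r≟i) , ≤∧≢⇒< j≤n (≡ᵇ-false⇒≢ j≟n)
...   | false | false = punchOutℕ-< i r n i≤n r≤n (≡ᵇ-false⇒≢ r≟i) , ≤∧≢⇒< j≤n (≡ᵇ-false⇒≢ j≟n)
hookSource-within n i j r c i≤n j≤n r≤n c≤n | false | false =
  punchOutℕ-< i r n i≤n r≤n (≡ᵇ-false⇒≢ r≟i) , punchOutℕ-< j c n j≤n c≤n (≡ᵇ-false⇒≢ c≟j)

eqPair-sound : ∀ p q → eqPair p q ≡ true → p ≡ q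
eqPair-sound (a , b) (c , d) h with ∧-true⁻ {a ≡ᵇ c} h
... | a≡c , b≡d = cong₂ _,_ (≡ᵇ-sound a≡c) (≡ᵇ-sound b≡d)

eqPair-refl : ∀ p → eqPair p p ≡ true
eqPair-refl (a , b) rewrite ≡ᵇ-refl a | ≡ᵇ-refl b = refl

length-filterᵇ-∷ : ∀ {A : Set} (g : A → Bool) x xs → length (filterᵇ g xs) ≤ length (filterᵇ g (x ∷ xs))
length-filterᵇ-∷ g x xs with g x
... | true = n≤1+n _
... | false = ≤-refl

module _ (g : ℕ × ℕ → Maybe (ℕ × ℕ)) (g-injective : ∀ p p′ {q} → g p ≡ just q → g p′ ≡ just q → p ≡ p′) where
  elemP-mapMaybe⁻ : ∀ lb p {q} → g p ≡ just q → elemP q (mapMaybe g lb) ≡ true → elemP p lb ≡ true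
  elemP-mapMaybe⁻ (p′ ∷ lb) p {q} gp h with g p′ in gp′
  ... | nothing = ∨-trueʳ (eqPair p p′) (elemP-mapMaybe⁻ lb p gp h)
  ... | just q′ with eqPair q q′ in q≟q′
  ...   | true rewrite g-injective p p′ gp (trans gp′ (cong just (sym (eqPair-sound q q′ q≟q′)))) | eqPair-refl p′ = refl
  ...   | false = ∨-trueʳ (eqPair p p′) (elemP-mapMaybe⁻ lb p gp h)

  common-mapMaybe-≤ : ∀ la lb → length (filterᵇ (λ p → elemP p (mapMaybe g lb)) (mapMaybe g la)) ≤ length (filterᵇ (λ p → elemP p lb) la)
  common-mapMaybe-≤ [] lb = z≤n
  common-mapMaybe-≤ (p ∷ la) lb with g p in gp
  ... | nothing = ≤-trans (common-mapMaybe-≤ la lb) (length-filterᵇ-∷ _ p la)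
  ... | just q with elemP q (mapMaybe g lb) in q∈
  ...   | true rewrite elemP-mapMaybe⁻ lb p gp q∈ = s≤s (common-mapMaybe-≤ la lb)
  ...   | false = ≤-trans (common-mapMaybe-≤ la lb) (length-filterᵇ-∷ _ p la)

count≡1⇒unique : ∀ n p j → j ≤ n → count (suc n) p ≡ 1 → p j ≡ true → ∀ c → c ≤ n → c ≢ j → p c ≡ false
count≡1⇒unique n p j j≤n one pj c c≤n c≢j = subst (λ x → p x ≡ false) (punchInℕ-punchOutℕ j c c≢j)
  (count≡0 n (p ∘ punchInℕ j) rest≡0 (punchOutℕ j c) (punchOutℕ-< j c n j≤n c≤n c≢j))
  where
  rest≡0 : count n (p ∘ punchInℕ j) ≡ 0
  rest≡0 = suc-injective (trans (cong (λ b → boolToℕ b + count n (p ∘ punchInℕ j)) (sym pj))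
                                (trans (sym (count-punchIn n p j j≤n)) one))

module RemoveHook (n : ℕ) (F : Tiling) (ed : Edges (suc n) F) (bo : BlankOutside (suc n) F)
                  (i j : ℕ) (i≤n : i ≤ n) (j≤n : j ≤ n) (relb-at : F i j ≡ relb)
                  (row-one : countRowᶠ (suc n) F i ≡ 1) (col-one : countColᶠ (suc n) F j ≡ 1) where
  open Edges ed

  N : ℕ
  N = suc n

  F⁻ : Tiling
  F⁻ r c = F (punchInℕ i r) (punchInℕ j c)

  no-relb-in-row : ∀ c → c ≤ n → c ≢ j → isRelb (F i c) ≡ false
  no-relb-in-row = count≡1⇒unique n (λ c → isRelb (F i c)) j j≤n row-one (cong isRelb relb-at)

  no-relb-in-col : ∀ r → r ≤ n → r ≢ i → isRelb (F r j) ≡ false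
  no-relb-in-col = count≡1⇒unique n (λ r → isRelb (F r j)) i i≤n col-one (cong isRelb relb-at)

  row-left : ∀ c → c < j → OneOf blank vert (F i c)
  row-left zero 0<j = noWest⇒blank⊎vert _ (west-boundary i (s≤s i≤n)) (no-relb-in-row 0 z≤n (<⇒≢ 0<j))
  row-left (suc c) c+1<j = noWest⇒blank⊎vert _
    (trans (sym (east-west i c (s≤s i≤n) (m≤n⇒m≤1+n (≤-trans c+1<j j≤n))))
           (oneOf-elim (λ t → eastE t ≡ false) refl refl (row-left c (<-trans (n<1+n c) c+1<j))))
    (no-relb-in-row (suc c) (<⇒≤ (≤-trans c+1<j j≤n)) (<⇒≢ c+1<j))

  row-right : ∀ d c → c + d ≡ n → j < c → OneOf hor cross (F i c)
  row-right zero c c+0≡n j<c = east⇒hor⊎cross _ (east-boundary i c (s≤s i≤n) (cong suc c≡n))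
    (no-relb-in-row c (≤-reflexive c≡n) (>⇒≢ j<c))
    where
    c≡n : c ≡ n
    c≡n = trans (sym (+-identityʳ c)) c+0≡n
  row-right (suc d) c c+d+1≡n j<c = east⇒hor⊎cross _
    (trans (east-west i c (s≤s i≤n) (s≤s (≤-trans (m≤m+n (suc c) d) (≤-reflexive c+1+d≡n))))
           (oneOf-elim (λ t → westE t ≡ true) refl refl (row-right d (suc c) c+1+d≡n (<-trans j<c (n<1+n c)))))
    (no-relb-in-row c (≤-trans (m≤m+n c (suc d)) (≤-reflexive c+d+1≡n)) (>⇒≢ j<c))
    where
    c+1+d≡n : suc c + d ≡ n
    c+1+d≡n = trans (sym (+-suc c d)) c+d+1≡n

  col-above : ∀ r → r < i → OneOf blank hor (F r j)
  col-above zero 0<i = noNorth⇒blank⊎hor _ (north-boundary j (s≤s j≤n)) (no-relb-in-col 0 z≤n (<⇒≢ 0<i))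
  col-above (suc r) r+1<i = noNorth⇒blank⊎hor _
    (trans (sym (south-north r j (m≤n⇒m≤1+n (≤-trans r+1<i i≤n)) (s≤s j≤n)))
           (oneOf-elim (λ t → southE t ≡ false) refl refl (col-above r (<-trans (n<1+n r) r+1<i))))
    (no-relb-in-col (suc r) (<⇒≤ (≤-trans r+1<i i≤n)) (<⇒≢ r+1<i))

  col-below : ∀ d r → r + d ≡ n → i < r → OneOf vert cross (F r j)
  col-below zero r r+0≡n i<r = south⇒vert⊎cross _ (south-boundary r j (cong suc r≡n) (s≤s j≤n))
    (no-relb-in-col r (≤-reflexive r≡n) (>⇒≢ i<r))
    where
    r≡n : r ≡ n
    r≡n = trans (sym (+-identityʳ r)) r+0≡n
  col-below (suc d) r r+d+1≡n i<r = south⇒vert⊎cross _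
    (trans (south-north r j (s≤s (≤-trans (m≤m+n (suc r) d) (≤-reflexive r+1+d≡n))) (s≤s j≤n))
           (oneOf-elim (λ t → northE t ≡ true) refl refl (col-below d (suc r) r+1+d≡n (<-trans i<r (n<1+n r)))))
    (no-relb-in-col r (≤-trans (m≤m+n r (suc d)) (≤-reflexive r+d+1≡n)) (>⇒≢ i<r))
    where
    r+1+d≡n : suc r + d ≡ n
    r+1+d≡n = trans (sym (+-suc r d)) r+d+1≡n

  row-right′ : ∀ c → j < c → c ≤ n → OneOf hor cross (F i c)
  row-right′ c j<c c≤n = row-right (n ∸ c) c (m+[n∸m]≡n c≤n) j<c

  col-below′ : ∀ r → i < r → r ≤ n → OneOf vert cross (F r j)
  col-below′ r i<r r≤n = col-below (n ∸ r) r (m+[n∸m]≡n r≤n) i<r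

  row-straight : ∀ c → c ≤ n → c ≢ j → straight (F i c) ≡ true
  row-straight c c≤n c≢j with trichotomy c j
  ... | inj₁ c<j = oneOf-elim (λ t → straight t ≡ true) refl refl (row-left c c<j)
  ... | inj₂ (inj₁ c≡j) = contradiction c≡j c≢j
  ... | inj₂ (inj₂ j<c) = oneOf-elim (λ t → straight t ≡ true) refl refl (row-right′ c j<c c≤n)

  col-straight : ∀ r → r ≤ n → r ≢ i → straight (F r j) ≡ true
  col-straight r r≤n r≢i with trichotomy r i
  ... | inj₁ r<i = oneOf-elim (λ t → straight t ≡ true) refl refl (col-above r r<i)
  ... | inj₂ (inj₁ r≡i) = contradiction r≡i r≢i
  ... | inj₂ (inj₂ i<r) = oneOf-elim (λ t → straight t ≡ true) refl refl (col-below′ r i<r r≤n)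

  row≤n : ∀ r → r < n → punchInℕ i r ≤ n
  row≤n r = punchInℕ-≤ i r n i≤n

  col≤n : ∀ c → c < n → punchInℕ j c ≤ n
  col≤n c = punchInℕ-≤ j c n j≤n

  blankOutside⁻ : BlankOutside n F⁻
  blankOutside⁻ r c (inj₁ n≤r) = bo _ _ (inj₁ (≤-trans (s≤s n≤r) (≤-reflexive (sym (punchInℕ-≥ i r (≤-trans i≤n n≤r))))))
  blankOutside⁻ r c (inj₂ n≤c) = bo _ _ (inj₂ (≤-trans (s≤s n≤c) (≤-reflexive (sym (punchInℕ-≥ j c (≤-trans j≤n n≤c))))))

  -- Where F⁻ joins two cells that were separated by the deleted column (row), the deleted
  -- tile in between is straight and so passes the segment on.
  east-west⁻ : ∀ r c → r < n → suc c < n → eastE (F⁻ r c) ≡ westE (F⁻ r (suc c))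
  east-west⁻ r c r<n c+1<n with punchInℕ-suc j c
  ... | inj₁ e rewrite e = east-west (punchInℕ i r) (punchInℕ j c) (s≤s (row≤n r r<n)) (s≤s (subst (_≤ n) e (col≤n (suc c) c+1<n)))
  ... | inj₂ (j≡c+1 , e) rewrite e | trans (cong (punchInℕ j) (sym j≡c+1)) (punchInℕ-self j) =
        trans (subst (λ x → eastE (F R c) ≡ westE (F R x)) (sym j≡c+1)
                     (east-west R c (s≤s (row≤n r r<n)) (s≤s (≤-trans (≤-reflexive (sym j≡c+1)) j≤n))))
              (trans (straight⇒west≡east _ (col-straight R (row≤n r r<n) (punchInℕ≢ i r)))
                     (east-west R j (s≤s (row≤n r r<n)) (s≤s (subst (λ x → suc x ≤ n) (sym j≡c+1) c+1<n))))
    where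
    R : ℕ
    R = punchInℕ i r

  east-boundary⁻ : ∀ r c → r < n → suc c ≡ n → eastE (F⁻ r c) ≡ true
  east-boundary⁻ r c r<n c+1≡n with trichotomy c j
  ... | inj₁ c<j rewrite punchInℕ-< j c c<j =
        trans (east-west R c (s≤s (row≤n r r<n)) (s≤s (≤-reflexive c+1≡n)))
        (trans (cong (λ x → westE (F R x)) (trans c+1≡n (sym j≡n)))
        (trans (straight⇒west≡east _ (col-straight R (row≤n r r<n) (punchInℕ≢ i r))) (east-boundary R j (s≤s (row≤n r r<n)) (cong suc j≡n))))
    where
    R : ℕ
    R = punchInℕ i r
    j≡n : j ≡ n
    j≡n = ≤-antisym j≤n (subst (_≤ j) c+1≡n c<j)
  ... | inj₂ (inj₁ c≡j) rewrite punchInℕ-≥ j c (≤-reflexive (sym c≡j)) =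
        east-boundary (punchInℕ i r) (suc c) (s≤s (row≤n r r<n)) (cong suc c+1≡n)
  ... | inj₂ (inj₂ j<c) rewrite punchInℕ-≥ j c (<⇒≤ j<c) = east-boundary (punchInℕ i r) (suc c) (s≤s (row≤n r r<n)) (cong suc c+1≡n)

  west-boundary⁻ : ∀ r → r < n → westE (F⁻ r 0) ≡ false
  west-boundary⁻ r r<n with punchInℕ-zero j
  ... | inj₁ (j≡0 , e) rewrite e =
        trans (sym (east-west R 0 (s≤s (row≤n r r<n)) (s≤s (≤-trans (s≤s z≤n) r<n))))
        (trans (sym (subst (λ x → westE (F R x) ≡ eastE (F R x)) j≡0 (straight⇒west≡east _ (col-straight R (row≤n r r<n) (punchInℕ≢ i r)))))
        (west-boundary R (s≤s (row≤n r r<n))))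
    where
    R : ℕ
    R = punchInℕ i r
  ... | inj₂ e rewrite e = west-boundary (punchInℕ i r) (s≤s (row≤n r r<n))

  south-north⁻ : ∀ r c → suc r < n → c < n → southE (F⁻ r c) ≡ northE (F⁻ (suc r) c)
  south-north⁻ r c r+1<n c<n with punchInℕ-suc i r
  ... | inj₁ e rewrite e = south-north (punchInℕ i r) (punchInℕ j c) (s≤s (subst (_≤ n) e (row≤n (suc r) r+1<n))) (s≤s (col≤n c c<n))
  ... | inj₂ (i≡r+1 , e) rewrite e | trans (cong (punchInℕ i) (sym i≡r+1)) (punchInℕ-self i) =
        trans (subst (λ x → southE (F r C) ≡ northE (F x C)) (sym i≡r+1)
                     (south-north r C (s≤s (≤-trans (≤-reflexive (sym i≡r+1)) i≤n)) (s≤s (col≤n c c<n))))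
              (trans (straight⇒north≡south _ (row-straight C (col≤n c c<n) (punchInℕ≢ j c)))
                     (south-north i C (s≤s (subst (λ x → suc x ≤ n) (sym i≡r+1) r+1<n)) (s≤s (col≤n c c<n))))
    where
    C : ℕ
    C = punchInℕ j c

  south-boundary⁻ : ∀ r c → suc r ≡ n → c < n → southE (F⁻ r c) ≡ true
  south-boundary⁻ r c r+1≡n c<n with trichotomy r i
  ... | inj₁ r<i rewrite punchInℕ-< i r r<i =
        trans (south-north r C (s≤s (≤-reflexive r+1≡n)) (s≤s (col≤n c c<n)))
        (trans (cong (λ x → northE (F x C)) (trans r+1≡n (sym i≡n)))
        (trans (straight⇒north≡south _ (row-straight C (col≤n c c<n) (punchInℕ≢ j c))) (south-boundary i C (cong suc i≡n) (s≤s (col≤n c c<n)))))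
    where
    C : ℕ
    C = punchInℕ j c
    i≡n : i ≡ n
    i≡n = ≤-antisym i≤n (subst (_≤ i) r+1≡n r<i)
  ... | inj₂ (inj₁ r≡i) rewrite punchInℕ-≥ i r (≤-reflexive (sym r≡i)) =
        south-boundary (suc r) (punchInℕ j c) (cong suc r+1≡n) (s≤s (col≤n c c<n))
  ... | inj₂ (inj₂ i<r) rewrite punchInℕ-≥ i r (<⇒≤ i<r) = south-boundary (suc r) (punchInℕ j c) (cong suc r+1≡n) (s≤s (col≤n c c<n))

  north-boundary⁻ : ∀ c → c < n → northE (F⁻ 0 c) ≡ false
  north-boundary⁻ c c<n with punchInℕ-zero i
  ... | inj₁ (i≡0 , e) rewrite e =
        trans (sym (south-north 0 C (s≤s (≤-trans (s≤s z≤n) c<n)) (s≤s (col≤n c c<n))))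
        (trans (sym (subst (λ x → northE (F x C) ≡ southE (F x C)) i≡0 (straight⇒north≡south _ (row-straight C (col≤n c c<n) (punchInℕ≢ j c)))))
        (north-boundary C (s≤s (col≤n c c<n))))
    where
    C : ℕ
    C = punchInℕ j c
  ... | inj₂ e rewrite e = north-boundary (punchInℕ j c) (s≤s (col≤n c c<n))

  edges⁻ : Edges n F⁻
  edges⁻ = record
    { east-west = east-west⁻ ; east-boundary = east-boundary⁻ ; west-boundary = west-boundary⁻
    ; south-north = south-north⁻ ; south-boundary = south-boundary⁻ ; north-boundary = north-boundary⁻ }

  deleteCross : ℕ × ℕ → Maybe (ℕ × ℕ)
  deleteCross (a , b) = if (a ≡ᵇ i) ∨ (b ≡ᵇ j) then nothing else just (punchOutℕ i a , punchOutℕ j b)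

  dropHook : List (ℕ × ℕ) → List (ℕ × ℕ)
  dropHook = mapMaybe deleteCross

  shrink : ℕ × List (ℕ × ℕ) → ℕ × List (ℕ × ℕ)
  shrink (x , l) = punchOutℕ i x , dropHook l

  dropHook-noteCross : ∀ t r c acc → dropHook (noteCross t (punchInℕ i r) (punchInℕ j c) acc) ≡ noteCross t r c (dropHook acc)
  dropHook-noteCross cross r c acc
    rewrite ≢⇒≡ᵇ-false (punchInℕ≢ i r) | ≢⇒≡ᵇ-false (punchInℕ≢ j c) | punchOutℕ-punchInℕ i r | punchOutℕ-punchInℕ j c = refl
  dropHook-noteCross blank r c acc = refl
  dropHook-noteCross hor r c acc = refl
  dropHook-noteCross vert r c acc = refl
  dropHook-noteCross relb r c acc = refl
  dropHook-noteCross jelb r c acc = refl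

  dropHook-noteCross-row : ∀ t c acc → dropHook (noteCross t i c acc) ≡ dropHook acc
  dropHook-noteCross-row cross c acc rewrite ≡ᵇ-refl i = refl
  dropHook-noteCross-row blank c acc = refl
  dropHook-noteCross-row hor c acc = refl
  dropHook-noteCross-row vert c acc = refl
  dropHook-noteCross-row relb c acc = refl
  dropHook-noteCross-row jelb c acc = refl

  dropHook-noteCross-col : ∀ t r acc → dropHook (noteCross t r j acc) ≡ dropHook acc
  dropHook-noteCross-col cross r acc rewrite ≡ᵇ-refl j with r ≡ᵇ i
  ... | true = refl
  ... | false = refl
  dropHook-noteCross-col blank r acc = refl
  dropHook-noteCross-col hor r acc = refl
  dropHook-noteCross-col vert r acc = refl
  dropHook-noteCross-col relb r acc = refl
  dropHook-noteCross-col jelb r acc = refl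

  up-through-row : ∀ f c acc {res} → c < n → traceᶠ N F (suc f) i (punchInℕ j c) fromS acc ≡ just res →
                   ∃ λ r′ → suc r′ ≡ i ×
                     traceᶠ N F f r′ (punchInℕ j c) fromS (noteCross (F i (punchInℕ j c)) i (punchInℕ j c) acc) ≡ just res
  up-through-row f c acc c<n h = goNorth-just i (straight-north _ (row-straight _ (col≤n c c<n) (punchInℕ≢ j c)) h)

  right-through-col : ∀ f r acc {res} → r < n → traceᶠ N F (suc f) (punchInℕ i r) j fromW acc ≡ just res →
                      goEast N F f (punchInℕ i r) j (noteCross (F (punchInℕ i r) j) (punchInℕ i r) j acc) ≡ just res
  right-through-col f r acc r<n = straight-east _ (col-straight _ (row≤n r r<n) (punchInℕ≢ i r))

  exit-shrinks : ∀ r acc acc′ {res} → dropHook acc′ ≡ dropHook acc → just (punchInℕ i r , acc′) ≡ just res →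
                 just (r , dropHook acc) ≡ just (shrink res)
  exit-shrinks r acc acc′ same h =
    cong just (trans (cong₂ _,_ (sym (punchOutℕ-punchInℕ i r)) (sym same)) (cong shrink (just-injective h)))

  -- A pipe of F not on the hook is traced in F⁻ along the same tiles, skipping the hook.
  mutual
    trace-shrinks : ∀ f f′ → f ≤ f′ → ∀ r c d acc {res} → r < n → c < n →
                    traceᶠ N F f (punchInℕ i r) (punchInℕ j c) d acc ≡ just res →
                    traceᶠ n F⁻ f′ r c d (dropHook acc) ≡ just (shrink res)
    trace-shrinks (suc f) (suc f′) (s≤s f≤f′) r c d acc {res} r<n c<n h =
      subst (λ a → move n F⁻ f′ r c (leave d (F⁻ r c)) a ≡ just (shrink res)) (dropHook-noteCross (F⁻ r c) r c acc)
        (move-shrinks f f′ f≤f′ r c (leave d (F⁻ r c)) _ r<n c<n h)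

    move-shrinks : ∀ f f′ → f ≤ f′ → ∀ r c m acc {res} → r < n → c < n →
                   move N F f (punchInℕ i r) (punchInℕ j c) m acc ≡ just res →
                   move n F⁻ f′ r c m (dropHook acc) ≡ just (shrink res)
    move-shrinks f f′ f≤f′ r c (just north) acc r<n c<n h = north-shrinks f f′ f≤f′ r c acc r<n c<n h
    move-shrinks f f′ f≤f′ r c (just east) acc r<n c<n h = east-shrinks f f′ f≤f′ r c acc r<n c<n h

    north-shrinks : ∀ f f′ → f ≤ f′ → ∀ r c acc {res} → r < n → c < n →
                    goNorth N F f (punchInℕ i r) (punchInℕ j c) acc ≡ just res →
                    goNorth n F⁻ f′ r c (dropHook acc) ≡ just (shrink res)
    north-shrinks f f′ f≤f′ zero c acc {res} r<n c<n h with punchInℕ-zero i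
    ... | inj₂ e rewrite e = contradiction h λ ()
    ... | inj₁ (i≡0 , e) rewrite e = ⊥-elim (top-row f h)
      where
      top-row : ∀ f → traceᶠ N F f 0 (punchInℕ j c) fromS acc ≡ just res → ⊥
      top-row (suc f) h′ with up-through-row f c acc c<n (subst (λ x → traceᶠ N F (suc f) x _ fromS acc ≡ just res) (sym i≡0) h′)
      ... | r′ , r′+1≡i , _ = contradiction (trans r′+1≡i i≡0) λ ()
    north-shrinks f f′ f≤f′ (suc r) c acc {res} r<n c<n h with punchInℕ-suc i r
    ... | inj₁ e rewrite e = trace-shrinks f f′ f≤f′ r c fromS acc (<-trans (n<1+n r) r<n) c<n h
    ... | inj₂ (i≡r+1 , e) rewrite trans (cong (punchInℕ i) (sym i≡r+1)) (punchInℕ-self i) = through-row f f≤f′ h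
      where
      C : ℕ
      C = punchInℕ j c
      through-row : ∀ f → f ≤ f′ → traceᶠ N F f i C fromS acc ≡ just res → traceᶠ n F⁻ f′ r c fromS (dropHook acc) ≡ just (shrink res)
      through-row (suc f) f+1≤f′ h′ with up-through-row f c acc c<n h′
      ... | r′ , r′+1≡i , h″ =
        subst (λ a → traceᶠ n F⁻ f′ r c fromS a ≡ just (shrink res)) (dropHook-noteCross-row (F i C) C acc)
          (trace-shrinks f f′ (<⇒≤ f+1≤f′) r c fromS _ (<-trans (n<1+n r) r<n) c<n
            (subst (λ x → traceᶠ N F f x C fromS _ ≡ just res) (trans (suc-injective (trans r′+1≡i i≡r+1)) (sym e)) h″))

    east-shrinks : ∀ f f′ → f ≤ f′ → ∀ r c acc {res} → r < n → c < n →
                   goEast N F f (punchInℕ i r) (punchInℕ j c) acc ≡ just res →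
                   goEast n F⁻ f′ r c (dropHook acc) ≡ just (shrink res)
    east-shrinks f f′ f≤f′ r c acc {res} r<n c<n h with trichotomy (suc c) n
    ... | inj₂ (inj₂ n<c+1) = contradiction c<n (≤⇒≯ (≤-pred n<c+1))
    ... | inj₂ (inj₁ c+1≡n) rewrite ≡ᵇ-complete c+1≡n = exit (trichotomy c j)
      where
      R : ℕ
      R = punchInℕ i r
      exit : c < j ⊎ c ≡ j ⊎ j < c → just (r , dropHook acc) ≡ just (shrink res)
      exit (inj₁ c<j) = through-last-col f
        (subst (λ x → traceᶠ N F f R x fromW acc ≡ just res) (trans (cong suc C≡c) (trans c+1≡n (sym j≡n)))
          (goEast-inner {F = F} {f = f} (λ q → <⇒≢ c<n (trans (sym C≡c) (suc-injective q))) h))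
        where
        j≡n : j ≡ n
        j≡n = ≤-antisym j≤n (subst (_≤ j) c+1≡n c<j)
        C≡c : punchInℕ j c ≡ c
        C≡c = punchInℕ-< j c c<j
        through-last-col : ∀ f → traceᶠ N F f R j fromW acc ≡ just res → just (r , dropHook acc) ≡ just (shrink res)
        through-last-col (suc f) h′ = exit-shrinks r acc _ (dropHook-noteCross-col (F R j) R acc)
          (goEast-last {F = F} {f = f} (cong suc j≡n) (right-through-col f r acc r<n h′))
      exit (inj₂ j≤c) = exit-shrinks r acc acc refl
        (goEast-last {F = F} {f = f} (cong suc (trans (punchInℕ-≥ j c ([ ≤-reflexive ∘ sym , <⇒≤ ]′ j≤c)) c+1≡n)) h)
    ... | inj₁ c+1<n rewrite ≢⇒≡ᵇ-false (<⇒≢ c+1<n) = next-col (punchInℕ-suc j c)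
      where
      R : ℕ
      R = punchInℕ i r
      C : ℕ
      C = punchInℕ j c
      h′ : traceᶠ N F f R (suc C) fromW acc ≡ just res
      h′ = goEast-inner {F = F} {f = f} (<⇒≢ (s≤s (≤-<-trans (punchInℕ≤suc j c) c+1<n))) h
      next-col : punchInℕ j (suc c) ≡ suc C ⊎ (j ≡ suc c × C ≡ c) → traceᶠ n F⁻ f′ r (suc c) fromW (dropHook acc) ≡ just (shrink res)
      next-col (inj₁ e) =
        trace-shrinks f f′ f≤f′ r (suc c) fromW acc r<n c+1<n (subst (λ x → traceᶠ N F f R x fromW acc ≡ just res) (sym e) h′)
      next-col (inj₂ (j≡c+1 , C≡c)) =
        through-col f f≤f′ (subst (λ x → traceᶠ N F f R x fromW acc ≡ just res) (trans (cong suc C≡c) (sym j≡c+1)) h′)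
        where
        through-col : ∀ f → f ≤ f′ → traceᶠ N F f R j fromW acc ≡ just res →
                      traceᶠ n F⁻ f′ r (suc c) fromW (dropHook acc) ≡ just (shrink res)
        through-col (suc f) f+1≤f′ h″ =
          subst (λ a → traceᶠ n F⁻ f′ r (suc c) fromW a ≡ just (shrink res)) (dropHook-noteCross-col (F R j) R acc)
            (trace-shrinks f f′ (<⇒≤ f+1≤f′) r (suc c) fromW _ r<n c+1<n
              (subst (λ x → traceᶠ N F f R x fromW (noteCross (F R j) R j acc) ≡ just res)
                     (sym (trans (cong (punchInℕ j) (sym j≡c+1)) (punchInℕ-self j)))
                (goEast-inner {F = F} {f = f} (λ q → <⇒≢ c+1<n (trans (sym j≡c+1) (suc-injective q))) (right-through-col f r acc r<n h″))))

  deleteCross-just : ∀ a b {q} → deleteCross (a , b) ≡ just q → a ≢ i × b ≢ j × q ≡ (punchOutℕ i a , punchOutℕ j b)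
  deleteCross-just a b h with a ≡ᵇ i in a≟i | b ≡ᵇ j in b≟j
  ... | false | false = ≡ᵇ-false⇒≢ a≟i , ≡ᵇ-false⇒≢ b≟j , sym (just-injective h)

  deleteCross-injective : ∀ p p′ {q} → deleteCross p ≡ just q → deleteCross p′ ≡ just q → p ≡ p′
  deleteCross-injective (a , b) (a′ , b′) h h′ with deleteCross-just a b h | deleteCross-just a′ b′ h′
  ... | a≢i , b≢j , q≡ | a′≢i , b′≢j , q≡′ = cong₂ _,_
    (trans (sym (punchInℕ-punchOutℕ i a a≢i)) (trans (cong (punchInℕ i) (,-injectiveˡ same)) (punchInℕ-punchOutℕ i a′ a′≢i)))
    (trans (sym (punchInℕ-punchOutℕ j b b≢j)) (trans (cong (punchInℕ j) (,-injectiveʳ same)) (punchInℕ-punchOutℕ j b′ b′≢j)))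
    where
    same : (punchOutℕ i a , punchOutℕ j b) ≡ (punchOutℕ i a′ , punchOutℕ j b′)
    same = trans (sym q≡) q≡′

  pipe-shrinks : ∀ c → c < n → ∀ {res} → pipeᶠ N F (punchInℕ j c) ≡ just res → pipeᶠ n F⁻ c ≡ just (shrink res)
  pipe-shrinks c c<n {res} h = traceᶠ-fuel n F⁻ (proj₁ start) (n ∸ 1) c fromS [] c<n (proj₂ start) (2 * n + 2) fuel-bound
    where
    C : ℕ
    C = punchInℕ j c
    n-1+1≡n : suc (n ∸ 1) ≡ n
    n-1+1≡n = trans (+-comm 1 (n ∸ 1)) (m∸n+n≡m (≤-trans (s≤s z≤n) c<n))
    fuel-bound : (n ∸ 1) + (n ∸ c) ≤ 2 * n + 2
    fuel-bound = ≤-trans (+-mono-≤ (m∸n≤m n 1) (m∸n≤m n c)) (≤-trans (≤-reflexive (cong (n +_) (sym (+-identityʳ n)))) (m≤m+n (2 * n) 2))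
    start : ∃ λ f → traceᶠ n F⁻ f (n ∸ 1) c fromS [] ≡ just (shrink res)
    start with trichotomy i n
    ... | inj₂ (inj₂ n<i) = contradiction i≤n (<⇒≱ n<i)
    ... | inj₁ i<n = _ , trace-shrinks (2 * N + 2) (2 * N + 2) ≤-refl (n ∸ 1) c fromS [] (≤-reflexive n-1+1≡n) c<n
                           (subst (λ x → traceᶠ N F (2 * N + 2) x C fromS [] ≡ just res)
                                  (sym (trans (punchInℕ-≥ i (n ∸ 1) (≤-pred (≤-trans i<n (≤-reflexive (sym n-1+1≡n))))) n-1+1≡n)) h)
    ... | inj₂ (inj₁ i≡n) = bottom-row (2 * N + 2) (subst (λ x → traceᶠ N F (2 * N + 2) x C fromS [] ≡ just res) (sym i≡n) h)
      where
      bottom-row : ∀ f → traceᶠ N F f i C fromS [] ≡ just res → ∃ λ f → traceᶠ n F⁻ f (n ∸ 1) c fromS [] ≡ just (shrink res)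
      bottom-row (suc f) h′ with up-through-row f c [] c<n h′
      ... | r′ , r′+1≡i , h″ = f , subst (λ a → traceᶠ n F⁻ f (n ∸ 1) c fromS a ≡ just (shrink res)) (dropHook-noteCross-row (F i C) C [])
              (trace-shrinks f f ≤-refl (n ∸ 1) c fromS _ (≤-reflexive n-1+1≡n) c<n
                (subst (λ x → traceᶠ N F f x C fromS _ ≡ just res) r′≡ h″))
        where
        r′≡ : r′ ≡ punchInℕ i (n ∸ 1)
        r′≡ = trans (suc-injective (trans r′+1≡i (trans i≡n (sym n-1+1≡n))))
                    (sym (punchInℕ-< i (n ∸ 1) (subst (n ∸ 1 <_) (sym i≡n) (≤-reflexive n-1+1≡n))))

  countRow⁻ : ∀ r → r < n → countRowᶠ n F⁻ r ≡ countRowᶠ N F (punchInℕ i r)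
  countRow⁻ r r<n = sym (trans (count-punchIn n (λ c → isRelb (F (punchInℕ i r) c)) j j≤n)
                               (cong (λ b → boolToℕ b + countRowᶠ n F⁻ r) (no-relb-in-col (punchInℕ i r) (row≤n r r<n) (punchInℕ≢ i r))))

  countCol⁻ : ∀ c → c < n → countColᶠ n F⁻ c ≡ countColᶠ N F (punchInℕ j c)
  countCol⁻ c c<n = sym (trans (count-punchIn n (λ r → isRelb (F r (punchInℕ j c))) i i≤n)
                               (cong (λ b → boolToℕ b + countColᶠ n F⁻ c) (no-relb-in-row (punchInℕ j c) (col≤n c c<n) (punchInℕ≢ j c))))

  by-south : ∀ {a b t} → OneOf a b t → southE a ≡ false → southE b ≡ true → t ≡ (if southE t then b else a)
  by-south (inj₁ refl) a-no _ rewrite a-no = refl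
  by-south (inj₂ refl) _ b-yes rewrite b-yes = refl

  by-east : ∀ {a b t} → OneOf a b t → eastE a ≡ false → eastE b ≡ true → t ≡ (if eastE t then b else a)
  by-east (inj₁ refl) a-no _ rewrite a-no = refl
  by-east (inj₂ refl) _ b-yes rewrite b-yes = refl

  from-below : ∀ c → c ≤ n → c ≢ j → ∀ t t′ →
               (if southE (F i c) then t else t′) ≡ resolve (if i ≡ᵇ n then fixed t else byNorth i (punchOutℕ j c) t t′) F⁻
  from-below c c≤n c≢j t t′ with i ≡ᵇ n in i≟n
  ... | true rewrite south-boundary i c (cong suc (≡ᵇ-sound i≟n)) (s≤s c≤n) = refl
  ... | false rewrite punchInℕ-self i | punchInℕ-punchOutℕ j c c≢j
                    | south-north i c (s≤s (≤∧≢⇒< i≤n (≡ᵇ-false⇒≢ i≟n))) (s≤s c≤n) = refl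

  from-left : ∀ r → r ≤ n → r ≢ i → ∀ t t′ →
              (if eastE (F r j) then t else t′) ≡ resolve (if j ≡ᵇ n then fixed t else byWest (punchOutℕ i r) j t t′) F⁻
  from-left r r≤n r≢i t t′ with j ≡ᵇ n in j≟n
  ... | true rewrite east-boundary r j (s≤s r≤n) (cong suc (≡ᵇ-sound j≟n)) = refl
  ... | false rewrite punchInℕ-self j | punchInℕ-punchOutℕ i r r≢i
                    | east-west r j (s≤s r≤n) (s≤s (≤∧≢⇒< j≤n (≡ᵇ-false⇒≢ j≟n))) = refl

  F≡insertHook : ∀ r c → r ≤ n → c ≤ n → F r c ≡ insertHook n i j F⁻ r c
  F≡insertHook r c r≤n c≤n with r ≟ i | c ≟ j
  ... | yes refl | yes refl rewrite ≡ᵇ-refl i | ≡ᵇ-refl j = relb-at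
  ... | yes refl | no c≢j rewrite ≡ᵇ-refl i | ≢⇒≡ᵇ-false c≢j with trichotomy c j
  ...   | inj₁ c<j rewrite <ᵇ-complete c<j = trans (by-south (row-left c c<j) refl refl) (from-below c c≤n c≢j vert blank)
  ...   | inj₂ (inj₁ c≡j) = contradiction c≡j c≢j
  ...   | inj₂ (inj₂ j<c) rewrite ≥⇒<ᵇ-false (<⇒≤ j<c) =
          trans (by-south (row-right′ c j<c c≤n) refl refl) (from-below c c≤n c≢j cross hor)
  F≡insertHook r c r≤n c≤n | no r≢i | yes refl rewrite ≢⇒≡ᵇ-false r≢i | ≡ᵇ-refl j with trichotomy r i
  ...   | inj₁ r<i rewrite <ᵇ-complete r<i = trans (by-east (col-above r r<i) refl refl) (from-left r r≤n r≢i hor blank)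
  ...   | inj₂ (inj₁ r≡i) = contradiction r≡i r≢i
  ...   | inj₂ (inj₂ i<r) rewrite ≥⇒<ᵇ-false (<⇒≤ i<r) = trans (by-east (col-below′ r i<r r≤n) refl refl) (from-left r r≤n r≢i cross vert)
  F≡insertHook r c r≤n c≤n | no r≢i | no c≢j
    rewrite ≢⇒≡ᵇ-false r≢i | ≢⇒≡ᵇ-false c≢j | punchInℕ-punchOutℕ i r r≢i | punchInℕ-punchOutℕ j c c≢j = refl

isRelb⇒relb : ∀ t → isRelb t ≡ true → t ≡ relb
isRelb⇒relb relb _ = refl

module RemovePipe (n : ℕ) (w : Permutation′ (suc n)) (F : Tiling) (bo : BlankOutside (suc n) F)
                  (lv : LocallyValid (suc n) F) (hp : Realises (suc n) F (w ⟨$⟩ʳ_)) (rd : Reduced (suc n) F)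
                  (k : Fin (suc n)) (removable-k : removableᶠ (suc n) F (w ⟨$⟩ʳ_) k ≡ true) where

  i j : ℕ
  i = toℕ k
  j = toℕ (w ⟨$⟩ʳ k)

  private
    relb-at : F i j ≡ relb
    relb-at = isRelb⇒relb _ (proj₁ (∧-true⁻ removable-k))

    counts : (countRowᶠ (suc n) F i ≡ᵇ 1) ≡ true × (countColᶠ (suc n) F j ≡ᵇ 1) ≡ true
    counts = ∧-true⁻ (proj₂ (∧-true⁻ {isRelb (F i j)} removable-k))

  open RemoveHook n F (locallyValid⇒edges _ _ lv) bo i j (toℕ-≤-pred k) (toℕ-≤-pred (w ⟨$⟩ʳ k)) relb-at
                  (≡ᵇ-sound (proj₁ counts)) (≡ᵇ-sound (proj₂ counts)) public

  w⁻ : Permutation′ n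
  w⁻ = remove k w

  locallyValid⁻ : LocallyValid n F⁻
  locallyValid⁻ = edges⇒locallyValid n F⁻ edges⁻

  realises⁻ : Realises n F⁻ (w⁻ ⟨$⟩ʳ_)
  realises⁻ k′ with hp (punchIn k k′)
  ... | l , h = dropHook l ,
    subst (λ x → pipeᶠ n F⁻ (toℕ (w⁻ ⟨$⟩ʳ k′)) ≡ just (x , dropHook l))
          (trans (cong (punchOutℕ i) (toℕ-punchIn k k′)) (punchOutℕ-punchInℕ i (toℕ k′)))
          (pipe-shrinks (toℕ (w⁻ ⟨$⟩ʳ k′)) (FP.toℕ<n _)
            (subst (λ c → pipeᶠ N F c ≡ just (toℕ (punchIn k k′) , l)) (sym (toℕ-remove w k k′)) h))

  pipe-exists : ∀ c → ∃ λ res → pipeᶠ N F (toℕ c) ≡ just res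
  pipe-exists c with hp (w ⟨$⟩ˡ c)
  ... | l , h = _ , subst (λ z → pipeᶠ N F (toℕ z) ≡ just (toℕ (w ⟨$⟩ˡ c) , l)) (inverseʳ w) h

  crosses⁻ : ∀ (c : Fin n) → crossesᶠ n F⁻ (toℕ c) ≡ dropHook (crossesᶠ N F (toℕ (punchIn (w ⟨$⟩ʳ k) c)))
  crosses⁻ c with pipe-exists (punchIn (w ⟨$⟩ʳ k) c)
  ... | res , h rewrite h | pipe-shrinks (toℕ c) (FP.toℕ<n c) (subst (λ z → pipeᶠ N F z ≡ just res) (toℕ-punchIn _ c) h) = refl

  reduced⁻ : Reduced n F⁻
  reduced⁻ a b a≢b rewrite crosses⁻ a | crosses⁻ b =
    ≤-trans (common-mapMaybe-≤ deleteCross deleteCross-injective (crossesᶠ N F (toℕ a′)) (crossesᶠ N F (toℕ b′)))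
            (rd a′ b′ (a≢b ∘ FP.punchIn-injective _ _ _))
    where
    a′ : Fin (suc n)
    a′ = punchIn (w ⟨$⟩ʳ k) a
    b′ : Fin (suc n)
    b′ = punchIn (w ⟨$⟩ʳ k) b

  removable⁻ : ∀ k′ → removableᶠ n F⁻ (w⁻ ⟨$⟩ʳ_) k′ ≡ removableᶠ (suc n) F (w ⟨$⟩ʳ_) (punchIn k k′)
  removable⁻ k′ rewrite countRow⁻ (toℕ k′) (FP.toℕ<n k′) | countCol⁻ (toℕ (w⁻ ⟨$⟩ʳ k′)) (FP.toℕ<n _)
                      | toℕ-remove w k k′ | sym (toℕ-punchIn k k′) = refl

≗-lookup⇒≡ : ∀ {A : Set} {m} {u v : Vec A m} → (∀ k → V.lookup u k ≡ V.lookup v k) → u ≡ v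
≗-lookup⇒≡ {u = u} {v} h = trans (sym (VP.tabulate∘lookup u)) (trans (VP.tabulate-cong h) (VP.tabulate∘lookup v))

lookup-removeAt : ∀ {A : Set} {m} (v : Vec A (suc m)) i k → V.lookup (V.removeAt v i) k ≡ V.lookup v (punchIn i k)
lookup-removeAt v i k = trans (cong (V.lookup (V.removeAt v i)) (sym (FP.punchOut-punchIn i))) (VP.removeAt-punchOut v _)

oneLineℕ : ∀ {m} → Permutation′ m → Vec ℕ m
oneLineℕ w = V.map toℕ (oneLineVec w)

lookup-oneLineℕ : ∀ {m} (w : Permutation′ m) k → V.lookup (oneLineℕ w) k ≡ toℕ (w ⟨$⟩ʳ k)
lookup-oneLineℕ w k = trans (VP.lookup-map k toℕ (oneLineVec w)) (cong toℕ (VP.lookup∘tabulate (w ⟨$⟩ʳ_) k))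

removeAt-oneLineℕ : ∀ {m} (w : Permutation′ (suc m)) i →
                    V.removeAt (oneLineℕ w) i ≡ V.map (punchInℕ (toℕ (w ⟨$⟩ʳ i))) (oneLineℕ (remove i w))
removeAt-oneLineℕ w i = ≗-lookup⇒≡ λ k → begin
  V.lookup (V.removeAt (oneLineℕ w) i) k                       ≡⟨ lookup-removeAt (oneLineℕ w) i k ⟩
  V.lookup (oneLineℕ w) (punchIn i k)                           ≡⟨ lookup-oneLineℕ w (punchIn i k) ⟩
  toℕ (w ⟨$⟩ʳ punchIn i k)                                      ≡⟨ toℕ-remove w i k ⟨
  punchInℕ (toℕ (w ⟨$⟩ʳ i)) (toℕ (remove i w ⟨$⟩ʳ k))            ≡⟨ cong (punchInℕ _) (lookup-oneLineℕ (remove i w) k) ⟨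
  punchInℕ (toℕ (w ⟨$⟩ʳ i)) (V.lookup (oneLineℕ (remove i w)) k) ≡⟨ VP.lookup-map k _ (oneLineℕ (remove i w)) ⟨
  V.lookup (V.map (punchInℕ (toℕ (w ⟨$⟩ʳ i))) (oneLineℕ (remove i w))) k ∎
  where open ≡-Reasoning

select : ∀ {A : Set} {m} → Vec Bool m → Vec A m → List A
select V.[] V.[] = []
select (true V.∷ ms) (x V.∷ xs) = x ∷ select ms xs
select (false V.∷ ms) (x V.∷ xs) = select ms xs

select-insertAt-false : ∀ {A : Set} {m} (ms : Vec Bool m) (v : Vec A (suc m)) i →
                        select (V.insertAt ms i false) v ≡ select ms (V.removeAt v i)
select-insertAt-false ms (x V.∷ xs) fz = refl
select-insertAt-false (true V.∷ ms) (x V.∷ y V.∷ ys) (fs i) = cong (x ∷_) (select-insertAt-false ms (y V.∷ ys) i)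
select-insertAt-false (false V.∷ ms) (x V.∷ y V.∷ ys) (fs i) = select-insertAt-false ms (y V.∷ ys) i

select-map : ∀ {A B : Set} {m} (f : A → B) (ms : Vec Bool m) (v : Vec A m) → select ms (V.map f v) ≡ map f (select ms v)
select-map f V.[] V.[] = refl
select-map f (true V.∷ ms) (x V.∷ xs) = cong (f x ∷_) (select-map f ms xs)
select-map f (false V.∷ ms) (x V.∷ xs) = select-map f ms xs

select-all : ∀ {A : Set} {m} (v : Vec A m) → select (V.replicate m true) v ≡ V.toList v
select-all V.[] = refl
select-all (x V.∷ v) = cong (x ∷_) (select-all v)

select∈subsequences : ∀ {m} (ms : Vec Bool m) (v : Vec ℕ m) → select ms v ∈ subsequences (V.toList v)
select∈subsequences V.[] V.[] = here refl
select∈subsequences (true V.∷ ms) (x V.∷ xs) = ∈-++⁺ˡ (∈-map⁺ (x ∷_) (select∈subsequences ms xs))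
select∈subsequences (false V.∷ ms) (x V.∷ xs) = ∈-++⁺ʳ (map (x ∷_) (subsequences (V.toList xs))) (select∈subsequences ms xs)

length-filterᵇ-map : ∀ {A B : Set} (p : B → Bool) (g : A → B) (q : A → Bool) → (∀ y → p (g y) ≡ q y) →
                     ∀ s → length (filterᵇ p (map g s)) ≡ length (filterᵇ q s)
length-filterᵇ-map p g q h [] = refl
length-filterᵇ-map p g q h (x ∷ s) rewrite h x with q x
... | true = cong suc (length-filterᵇ-map p g q h s)
... | false = length-filterᵇ-map p g q h s

standardize-map-punchInℕ : ∀ a s → standardize (map (punchInℕ a) s) ≡ standardize s
standardize-map-punchInℕ a s = trans (sym (LP.map-∘ s))
  (LP.map-cong (λ x → length-filterᵇ-map (_<ᵇ punchInℕ a x) (punchInℕ a) (_<ᵇ x) (λ y → punchInℕ-<ᵇ a y x) s) s)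

punchInℕ-<ᵇ-≤ : ∀ a y v → v ≤ a → (punchInℕ a y <ᵇ v) ≡ (y <ᵇ v)
punchInℕ-<ᵇ-≤ zero y zero _ = refl
punchInℕ-<ᵇ-≤ (suc a) zero v _ = refl
punchInℕ-<ᵇ-≤ (suc a) (suc y) zero _ = refl
punchInℕ-<ᵇ-≤ (suc a) (suc y) (suc v) (s≤s v≤a) = punchInℕ-<ᵇ-≤ a y v v≤a

punchInℕ-<ᵇ-> : ∀ a y v → a < v → (punchInℕ a y <ᵇ v) ≡ (y <ᵇ pred v)
punchInℕ-<ᵇ-> zero y (suc v) _ = refl
punchInℕ-<ᵇ-> (suc a) zero (suc zero) (s≤s ())
punchInℕ-<ᵇ-> (suc a) zero (suc (suc v)) _ = refl
punchInℕ-<ᵇ-> (suc a) (suc y) (suc (suc v)) (s≤s a<v) = punchInℕ-<ᵇ-> a y (suc v) a<v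

oneLineℕ-∷ : ∀ {m} (w : Permutation′ (suc m)) →
             V.toList (oneLineℕ w) ≡ toℕ (w ⟨$⟩ʳ fz) ∷ map (punchInℕ (toℕ (w ⟨$⟩ʳ fz))) (V.toList (oneLineℕ (remove fz w)))
oneLineℕ-∷ w = cong (toℕ (w ⟨$⟩ʳ fz) ∷_)
  (trans (cong V.toList (removeAt-oneLineℕ w fz)) (VP.toList-map _ (oneLineℕ (remove fz w))))

-- Removing the first entry a of w lowers by one exactly the entries above a.
count-below-oneLineℕ : ∀ m (w : Permutation′ m) v → v ≤ m → length (filterᵇ (_<ᵇ v) (V.toList (oneLineℕ w))) ≡ v
count-below-oneLineℕ zero w zero _ = refl
count-below-oneLineℕ (suc m) w v v≤m+1 =
  trans (cong (λ l → length (filterᵇ (_<ᵇ v) l)) (oneLineℕ-∷ w)) (by-cases (trichotomy v a))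
  where
  a : ℕ
  a = toℕ (w ⟨$⟩ʳ fz)
  rest : ∀ v′ → (∀ y → (punchInℕ a y <ᵇ v) ≡ (y <ᵇ v′)) → v′ ≤ m →
         length (filterᵇ (_<ᵇ v) (map (punchInℕ a) (V.toList (oneLineℕ (remove fz w))))) ≡ v′
  rest v′ h v′≤m = trans (length-filterᵇ-map (_<ᵇ v) (punchInℕ a) (_<ᵇ v′) h (V.toList (oneLineℕ (remove fz w))))
                         (count-below-oneLineℕ m (remove fz w) v′ v′≤m)
  by-cases : v < a ⊎ v ≡ a ⊎ a < v → length (filterᵇ (_<ᵇ v) (a ∷ map (punchInℕ a) (V.toList (oneLineℕ (remove fz w))))) ≡ v
  by-cases (inj₁ v<a) rewrite ≥⇒<ᵇ-false (<⇒≤ v<a) =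
    rest v (λ y → punchInℕ-<ᵇ-≤ a y v (<⇒≤ v<a)) (≤-trans (<⇒≤ v<a) (toℕ-≤-pred _))
  by-cases (inj₂ (inj₁ v≡a)) rewrite ≥⇒<ᵇ-false (≤-reflexive v≡a) =
    rest v (λ y → punchInℕ-<ᵇ-≤ a y v (≤-reflexive v≡a)) (≤-trans (≤-reflexive v≡a) (toℕ-≤-pred _))
  by-cases (inj₂ (inj₂ a<v)) rewrite <ᵇ-complete a<v = trans
    (cong suc (rest (pred v) (λ y → punchInℕ-<ᵇ-> a y v a<v) (≤-pred (≤-trans (≤-reflexive v-1+1≡v) v≤m+1))))
    v-1+1≡v
    where
    v-1+1≡v : suc (pred v) ≡ v
    v-1+1≡v = suc-pred v {{>-nonZero (≤-trans (s≤s z≤n) a<v)}}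

standardize-oneLineℕ : ∀ m (w : Permutation′ m) → standardize (V.toList (oneLineℕ w)) ≡ V.toList (oneLineℕ w)
standardize-oneLineℕ m w = trans (LP.map-cong-local (All.map (λ {x} x<m → count-below-oneLineℕ m w x (<⇒≤ x<m)) (entries<m (oneLineVec w))))
                                 (LP.map-id _)
  where
  entries<m : ∀ {k} (v : Vec (Fin m) k) → All (_< m) (V.toList (V.map toℕ v))
  entries<m V.[] = []
  entries<m (x V.∷ v) = FP.toℕ<n x ∷ entries<m v

memberᵇ : ℕ → List ℕ → Bool
memberᵇ x [] = false
memberᵇ x (y ∷ ys) = (x ≡ᵇ y) ∨ memberᵇ x ys

maskOf : ∀ {m} → Permutation′ m → List ℕ → Vec Bool m
maskOf w s = V.tabulate (λ k → memberᵇ (toℕ (w ⟨$⟩ʳ k)) s)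

memberᵇ-select-∉ : ∀ {m} x (xs : Vec ℕ m) ms → (∀ k → V.lookup xs k ≢ x) → memberᵇ x (select ms xs) ≡ false
memberᵇ-select-∉ x V.[] V.[] h = refl
memberᵇ-select-∉ x (y V.∷ xs) (true V.∷ ms) h rewrite ≢⇒≡ᵇ-false (h fz ∘ sym) = memberᵇ-select-∉ x xs ms (h ∘ fs)
memberᵇ-select-∉ x (y V.∷ xs) (false V.∷ ms) h = memberᵇ-select-∉ x xs ms (h ∘ fs)

memberᵇ-select : ∀ {m} (v : Vec ℕ m) → (∀ a b → V.lookup v a ≡ V.lookup v b → a ≡ b) →
                 ∀ ms k → memberᵇ (V.lookup v k) (select ms v) ≡ V.lookup ms k
memberᵇ-select (x V.∷ xs) inj (true V.∷ ms) fz rewrite ≡ᵇ-refl x = refl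
memberᵇ-select (x V.∷ xs) inj (false V.∷ ms) fz = memberᵇ-select-∉ x xs ms (λ k e → FP.0≢1+n (sym (inj (fs k) fz e)))
memberᵇ-select (x V.∷ xs) inj (true V.∷ ms) (fs k) rewrite ≢⇒≡ᵇ-false (λ e → FP.0≢1+n (sym (inj (fs k) fz e))) =
  memberᵇ-select xs (λ a b e → FP.suc-injective (inj (fs a) (fs b) e)) ms k
memberᵇ-select (x V.∷ xs) inj (false V.∷ ms) (fs k) = memberᵇ-select xs (λ a b e → FP.suc-injective (inj (fs a) (fs b) e)) ms k

maskOf-select : ∀ {m} (w : Permutation′ m) ms → maskOf w (select ms (oneLineℕ w)) ≡ ms
maskOf-select w ms = ≗-lookup⇒≡ λ k → trans (VP.lookup∘tabulate _ k)
  (trans (cong (λ z → memberᵇ z (select ms (oneLineℕ w))) (sym (lookup-oneLineℕ w k)))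
         (memberᵇ-select (oneLineℕ w) oneLineℕ-injective ms k))
  where
  oneLineℕ-injective : ∀ a b → V.lookup (oneLineℕ w) a ≡ V.lookup (oneLineℕ w) b → a ≡ b
  oneLineℕ-injective a b e = perm-injective w (FP.toℕ-injective (trans (sym (lookup-oneLineℕ w a)) (trans e (lookup-oneLineℕ w b))))

firstFalse : ∀ {m} → Vec Bool m → Maybe (Fin m)
firstFalse V.[] = nothing
firstFalse (false V.∷ v) = just fz
firstFalse (true V.∷ v) = M.map fs (firstFalse v)

firstFalse-all : ∀ m → firstFalse (V.replicate m true) ≡ nothing
firstFalse-all zero = refl
firstFalse-all (suc m) rewrite firstFalse-all m = refl

firstFalse-insertAt : ∀ {m} (ms : Vec Bool m) (i : Fin (suc m)) → (∀ k → toℕ k < toℕ i → V.lookup ms k ≡ true) →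
                      firstFalse (V.insertAt ms i false) ≡ just i
firstFalse-insertAt ms fz h = refl
firstFalse-insertAt (b V.∷ ms) (fs i) h rewrite h fz (s≤s z≤n) | firstFalse-insertAt ms i (λ k lt → h (fs k) (s≤s lt)) = refl

reinsertHooks : (m : ℕ) → Permutation′ m → Vec Bool m → Tiling → Tiling
reinsertHooks zero w mask F = F
reinsertHooks (suc m) w mask F with firstFalse mask
... | nothing = F
... | just i = insertHook m (toℕ i) (toℕ (w ⟨$⟩ʳ i)) (reinsertHooks m (remove i w) (V.removeAt mask i) F)

reinsertHooks-just : ∀ m w mask F i → firstFalse mask ≡ just i →
                     reinsertHooks (suc m) w mask F ≡ insertHook m (toℕ i) (toℕ (w ⟨$⟩ʳ i)) (reinsertHooks m (remove i w) (V.removeAt mask i) F)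
reinsertHooks-just m w mask F i e with firstFalse mask
reinsertHooks-just m w mask F i refl | just .i = refl

reinsertHooks-all : ∀ m w F → reinsertHooks m w (V.replicate m true) F ≡ F
reinsertHooks-all zero w F = refl
reinsertHooks-all (suc m) w F with firstFalse (V.replicate (suc m) true) | firstFalse-all (suc m)
... | nothing | refl = refl

reinsertHooks-cong : ∀ m w mask {F G} → F ≗₂ G → reinsertHooks m w mask F ≗₂ reinsertHooks m w mask G
reinsertHooks-cong zero w mask F≗G = F≗G
reinsertHooks-cong (suc m) w mask F≗G with firstFalse mask
... | nothing = F≗G
... | just i = λ r c → resolve-cong (hookSource m (toℕ i) (toℕ (w ⟨$⟩ʳ i)) r c) (reinsertHooks-cong m (remove i w) (V.removeAt mask i) F≗G)

firstTrue : ∀ {m} (p : Fin m → Bool) → (∀ k → p k ≡ false) ⊎ Σ (Fin m) (λ i → p i ≡ true × (∀ k → toℕ k < toℕ i → p k ≡ false))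
firstTrue {zero} p = inj₁ λ ()
firstTrue {suc m} p with p fz in p0
... | true = inj₂ (fz , p0 , λ k ())
... | false with firstTrue (p ∘ fs)
...   | inj₁ none = inj₁ λ { fz → p0 ; (fs k) → none k }
...   | inj₂ (i , pi , before) = inj₂ (fs i , pi , λ { fz _ → p0 ; (fs k) (s≤s k<i) → before k k<i })

record Minimisation (m : ℕ) (w : Permutation′ m) (F : Tiling) : Set where
  field
    size : ℕ
    size≤m : size ≤ m
    kept : Vec Bool m
    core-perm : Permutation′ size
    core : Tiling
    core-blankOutside : BlankOutside size core
    core-locallyValid : LocallyValid size core
    core-realises : Realises size core (core-perm ⟨$⟩ʳ_)
    core-reduced : Reduced size core
    core-minimal : Minimal size core (core-perm ⟨$⟩ʳ_)
    reconstructs : ∀ r c → r < m → c < m → F r c ≡ reinsertHooks m w kept core r c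
    occurrence : standardize (select kept (oneLineℕ w)) ≡ V.toList (oneLineℕ core-perm)
    dropped-removable : ∀ k → V.lookup kept k ≡ false → removableᶠ m F (w ⟨$⟩ʳ_) k ≡ true

already-minimal : ∀ m w F → BlankOutside m F → LocallyValid m F → Realises m F (w ⟨$⟩ʳ_) → Reduced m F →
                  Minimal m F (w ⟨$⟩ʳ_) → Minimisation m w F
already-minimal m w F bo lv hp rd minimal = record
  { size = m ; size≤m = ≤-refl ; kept = V.replicate m true ; core-perm = w ; core = F
  ; core-blankOutside = bo ; core-locallyValid = lv ; core-realises = hp ; core-reduced = rd ; core-minimal = minimal
  ; reconstructs = λ r c _ _ → cong (λ G → G r c) (sym (reinsertHooks-all m w F))
  ; occurrence = trans (cong standardize (select-all (oneLineℕ w))) (standardize-oneLineℕ m w)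
  ; dropped-removable = λ k kept≡false → contradiction (trans (sym (VP.lookup-replicate k true)) kept≡false) λ () }

-- Always removing the first removable pipe makes it the first dropped position, so that
-- reinsertHooks puts it back last.
minimise : ∀ m w F → BlankOutside m F → LocallyValid m F → Realises m F (w ⟨$⟩ʳ_) → Reduced m F → Minimisation m w F
minimise zero w F bo lv hp rd = already-minimal zero w F bo lv hp rd λ ()
minimise (suc n) w F bo lv hp rd with firstTrue (removableᶠ (suc n) F (w ⟨$⟩ʳ_))
... | inj₁ none = already-minimal (suc n) w F bo lv hp rd none
... | inj₂ (k , removable-k , earlier-not) = record
  { size = size ; size≤m = m≤n⇒m≤1+n size≤m ; kept = kept′ ; core-perm = core-perm ; core = core
  ; core-blankOutside = core-blankOutside ; core-locallyValid = core-locallyValid ; core-realises = core-realises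
  ; core-reduced = core-reduced ; core-minimal = core-minimal
  ; reconstructs = reconstructs′ ; occurrence = occurrence′ ; dropped-removable = dropped-removable′ }
  where
  module P = RemovePipe n w F bo lv hp rd k removable-k
  open Minimisation (minimise n P.w⁻ P.F⁻ P.blankOutside⁻ P.locallyValid⁻ P.realises⁻ P.reduced⁻)

  kept′ : Vec Bool (suc n)
  kept′ = V.insertAt kept k false

  kept-before-k : ∀ k′ → toℕ k′ < toℕ k → V.lookup kept k′ ≡ true
  kept-before-k k′ k′<k with V.lookup kept k′ in kept-k′
  ... | true = refl
  ... | false = contradiction (trans (sym (P.removable⁻ k′)) (dropped-removable k′ kept-k′))
    (λ removable → contradiction (trans (sym removable) (earlier-not (punchIn k k′)
       (subst (_< toℕ k) (sym (trans (toℕ-punchIn k k′) (punchInℕ-< (toℕ k) (toℕ k′) k′<k))) k′<k))) λ ())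

  reinsert-unfold : reinsertHooks (suc n) w kept′ core ≡ insertHook n P.i P.j (reinsertHooks n P.w⁻ kept core)
  reinsert-unfold = trans (reinsertHooks-just n w kept′ core k (firstFalse-insertAt kept k kept-before-k))
                          (cong (λ ms → insertHook n P.i P.j (reinsertHooks n P.w⁻ ms core)) (VP.removeAt-insertAt kept k false))

  reconstructs′ : ∀ r c → r < suc n → c < suc n → F r c ≡ reinsertHooks (suc n) w kept′ core r c
  reconstructs′ r c r<m c<m = begin
    F r c                                                    ≡⟨ P.F≡insertHook r c (≤-pred r<m) (≤-pred c<m) ⟩
    insertHook n P.i P.j P.F⁻ r c                             ≡⟨ resolve-congWithin n (hookSource n P.i P.j r c) reconstructs
                                                                  (hookSource-within n P.i P.j r c (toℕ-≤-pred k) (toℕ-≤-pred (w ⟨$⟩ʳ k)) (≤-pred r<m) (≤-pred c<m)) ⟩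
    insertHook n P.i P.j (reinsertHooks n P.w⁻ kept core) r c ≡⟨ cong (λ G → G r c) reinsert-unfold ⟨
    reinsertHooks (suc n) w kept′ core r c ∎
    where open ≡-Reasoning

  occurrence′ : standardize (select kept′ (oneLineℕ w)) ≡ V.toList (oneLineℕ core-perm)
  occurrence′ = begin
    standardize (select kept′ (oneLineℕ w))                                ≡⟨ cong standardize (select-insertAt-false kept (oneLineℕ w) k) ⟩
    standardize (select kept (V.removeAt (oneLineℕ w) k))                  ≡⟨ cong (standardize ∘ select kept) (removeAt-oneLineℕ w k) ⟩
    standardize (select kept (V.map (punchInℕ P.j) (oneLineℕ P.w⁻)))       ≡⟨ cong standardize (select-map (punchInℕ P.j) kept (oneLineℕ P.w⁻)) ⟩
    standardize (map (punchInℕ P.j) (select kept (oneLineℕ P.w⁻)))         ≡⟨ standardize-map-punchInℕ P.j _ ⟩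
    standardize (select kept (oneLineℕ P.w⁻))                              ≡⟨ occurrence ⟩
    V.toList (oneLineℕ core-perm) ∎
    where open ≡-Reasoning

  dropped-removable′ : ∀ k′ → V.lookup kept′ k′ ≡ false → removableᶠ (suc n) F (w ⟨$⟩ʳ_) k′ ≡ true
  dropped-removable′ k′ dropped with k FP.≟ k′
  ... | yes refl = removable-k
  ... | no k≢k′ = subst (λ z → removableᶠ (suc n) F (w ⟨$⟩ʳ_) z ≡ true) (FP.punchIn-punchOut k≢k′)
    (trans (sym (P.removable⁻ (punchOut k≢k′)))
      (dropped-removable (punchOut k≢k′)
        (trans (sym (VP.insertAt-punchIn kept k false (punchOut k≢k′)))
               (subst (λ z → V.lookup kept′ z ≡ false) (sym (FP.punchIn-punchOut k≢k′)) dropped))))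

getD-toList : ∀ {A : Set} {m} (v : Vec A m) (k : Fin m) d → getD (V.toList v) (toℕ k) d ≡ V.lookup v k
getD-toList (x V.∷ v) fz d = refl
getD-toList (x V.∷ v) (fs k) d = getD-toList v k d

getD-toList-≥ : ∀ {A : Set} {m} (v : Vec A m) k d → m ≤ k → getD (V.toList v) k d ≡ d
getD-toList-≥ V.[] k d _ = refl
getD-toList-≥ (x V.∷ v) (suc k) d (s≤s m≤k) = getD-toList-≥ v k d m≤k

tileAt-row : ∀ {m} (G : Grid m) (r : Fin m) c → tileAt G (toℕ r) c ≡ getD (V.toList (V.lookup G r)) c blank
tileAt-row G r c = cong (λ z → getD z c blank) (trans (getD-toList (V.map V.toList G) r []) (VP.lookup-map r V.toList G))

tileAt-lookup : ∀ {m} (G : Grid m) r c → tileAt G (toℕ r) (toℕ c) ≡ V.lookup (V.lookup G r) c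
tileAt-lookup G r c = trans (tileAt-row G r (toℕ c)) (getD-toList (V.lookup G r) c blank)

tileAt-blankOutside : ∀ {m} (G : Grid m) → BlankOutside m (tileAt G)
tileAt-blankOutside {m} G r c (inj₁ m≤r) rewrite getD-toList-≥ (V.map V.toList G) r [] m≤r = refl
tileAt-blankOutside {m} G r c (inj₂ m≤c) with r <? m
... | yes r<m = trans (cong (λ x → tileAt G x c) (sym (FP.toℕ-fromℕ< r<m)))
                      (trans (tileAt-row G (fromℕ< r<m) c) (getD-toList-≥ (V.lookup G (fromℕ< r<m)) c blank m≤c))
... | no r≮m rewrite getD-toList-≥ (V.map V.toList G) r [] (≮⇒≥ r≮m) = refl

fromTiling : (m : ℕ) → Tiling → Grid m
fromTiling m F = V.tabulate (λ r → V.tabulate (λ c → F (toℕ r) (toℕ c)))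

tileAt-fromTiling : ∀ m F → BlankOutside m F → tileAt (fromTiling m F) ≗₂ F
tileAt-fromTiling m F bo r c with r <? m | c <? m
... | yes r<m | yes c<m = begin
  tileAt (fromTiling m F) r c                                      ≡⟨ cong₂ (tileAt (fromTiling m F)) (FP.toℕ-fromℕ< r<m) (FP.toℕ-fromℕ< c<m) ⟨
  tileAt (fromTiling m F) (toℕ (fromℕ< r<m)) (toℕ (fromℕ< c<m))   ≡⟨ tileAt-lookup (fromTiling m F) (fromℕ< r<m) (fromℕ< c<m) ⟩
  V.lookup (V.lookup (fromTiling m F) (fromℕ< r<m)) (fromℕ< c<m)  ≡⟨ cong (λ row → V.lookup row (fromℕ< c<m)) (VP.lookup∘tabulate _ (fromℕ< r<m)) ⟩
  V.lookup (V.tabulate (λ c′ → F (toℕ (fromℕ< r<m)) (toℕ c′))) (fromℕ< c<m) ≡⟨ VP.lookup∘tabulate _ (fromℕ< c<m) ⟩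
  F (toℕ (fromℕ< r<m)) (toℕ (fromℕ< c<m))                         ≡⟨ cong₂ F (FP.toℕ-fromℕ< r<m) (FP.toℕ-fromℕ< c<m) ⟩
  F r c ∎
  where open ≡-Reasoning
... | yes _ | no c≮m = trans (tileAt-blankOutside (fromTiling m F) r c (inj₂ (≮⇒≥ c≮m))) (sym (bo r c (inj₂ (≮⇒≥ c≮m))))
... | no r≮m | _ = trans (tileAt-blankOutside (fromTiling m F) r c (inj₁ (≮⇒≥ r≮m))) (sym (bo r c (inj₁ (≮⇒≥ r≮m))))

fromTiling-tileAt : ∀ m (G : Grid m) F → (∀ r c → r < m → c < m → F r c ≡ tileAt G r c) → fromTiling m F ≡ G
fromTiling-tileAt m G F h = ≗-lookup⇒≡ λ r → trans (VP.lookup∘tabulate _ r) (≗-lookup⇒≡ λ c →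
  trans (VP.lookup∘tabulate _ c) (trans (h (toℕ r) (toℕ c) (FP.toℕ<n r) (FP.toℕ<n c)) (tileAt-lookup G r c)))

module _ {m : ℕ} (G : Grid m) where
  locallyValid-sound : locallyValid G ≡ true → LocallyValid m (tileAt G)
  locallyValid-sound h r c r<m c<m = subst₂ (λ a b → cellOK G a b ≡ true) (FP.toℕ-fromℕ< r<m) (FP.toℕ-fromℕ< c<m)
    (allB⁻ _ (allB⁻ _ h (fromℕ< r<m)) (fromℕ< c<m))

  locallyValid-complete : ∀ {F} → tileAt G ≗₂ F → LocallyValid m F → locallyValid G ≡ true
  locallyValid-complete G≗F lv = allB⁺ _ λ r → allB⁺ _ λ c →
    trans (cellOKᶠ-cong m G≗F (toℕ r) (toℕ c)) (lv _ _ (FP.toℕ<n r) (FP.toℕ<n c))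

  hasPerm-sound : ∀ v → hasPerm G v ≡ true → Realises m (tileAt G) (V.lookup v)
  hasPerm-sound v h k with allB⁻ _ h k
  ... | exits-at-k with pipeFrom G (toℕ (V.lookup v k)) | pipeFrom≡pipeᶠ G (toℕ (V.lookup v k))
  ...   | just (r , l) | e = l , trans (sym e) (cong (λ x → just (x , l)) (≡ᵇ-sound exits-at-k))

  hasPerm-complete : ∀ v → Realises m (tileAt G) (V.lookup v) → hasPerm G v ≡ true
  hasPerm-complete v h with hasPerm G v in hasPerm≡
  ... | true = refl
  ... | false with allB-false _ hasPerm≡
  ...   | k , fails-at-k with pipeFrom G (toℕ (V.lookup v k)) | trans (pipeFrom≡pipeᶠ G (toℕ (V.lookup v k))) (proj₂ (h k))
  ...     | just _ | refl = contradiction (trans (sym fails-at-k) (≡ᵇ-refl (toℕ k))) λ ()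

  reducedB-sound : reducedB G ≡ true → Reduced m (tileAt G)
  reducedB-sound h a b a≢b with allB⁻ _ (allB⁻ _ h a) b
  ... | le rewrite ≢⇒≡ᵇ-false (a≢b ∘ FP.toℕ-injective) =
    subst (_≤ 1) (crossCount≡crossCountᶠ G (toℕ a) (toℕ b)) (≤ᵇ-sound le)

  reducedB-complete : ∀ {F} → tileAt G ≗₂ F → Reduced m F → reducedB G ≡ true
  reducedB-complete G≗F rd = allB⁺ _ λ a → allB⁺ _ λ b → pair a b
    where
    pair : ∀ a b → eqFin a b ∨ (crossCount G (toℕ a) (toℕ b) ≤ᵇ 1) ≡ true
    pair a b with a FP.≟ b
    ... | yes refl rewrite ≡ᵇ-refl (toℕ a) = refl
    ... | no a≢b = ∨-trueʳ (eqFin a b) (≤ᵇ-complete (subst (_≤ 1)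
            (sym (trans (crossCount≡crossCountᶠ G (toℕ a) (toℕ b)) (crossCountᶠ-cong m G≗F _ _))) (rd a b a≢b)))

∈-─ : ∀ {A : Set} {x y : A} {ys} → y ∈ ys → (x∈ys : x ∈ ys) → y ≢ x → y ∈ (ys ─ x∈ys)
∈-─ (here y≡z) (here x≡z) y≢x = contradiction (trans y≡z (sym x≡z)) y≢x
∈-─ (here y≡z) (there x∈ys) _ = here y≡z
∈-─ (there y∈ys) (here _) _ = y∈ys
∈-─ (there y∈ys) (there x∈ys) y≢x = there (∈-─ y∈ys x∈ys y≢x)

length-≤-⊆ : ∀ {A : Set} (xs ys : List A) → Unique xs → (∀ {x} → x ∈ xs → x ∈ ys) → length xs ≤ length ys
length-≤-⊆ [] ys _ _ = z≤n
length-≤-⊆ (x ∷ xs) ys (x∉xs ∷ unique) xs⊆ys = begin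
  suc (length xs)          ≤⟨ s≤s (length-≤-⊆ xs (ys ─ x∈ys) unique xs⊆ys─x∈ys) ⟩
  suc (length (ys ─ x∈ys)) ≡⟨ LP.length-removeAt′ ys (Any.index x∈ys) ⟨
  length ys ∎
  where
  open ≤-Reasoning
  x∈ys : x ∈ ys
  x∈ys = xs⊆ys (here refl)
  xs⊆ys─x∈ys : ∀ {y} → y ∈ xs → y ∈ (ys ─ x∈ys)
  xs⊆ys─x∈ys y∈xs = ∈-─ (xs⊆ys (there y∈xs)) x∈ys (λ y≡x → All.lookup x∉xs y∈xs (sym y≡x))

length-concatMap : ∀ {A B : Set} (f : A → List B) xs → length (concatMap f xs) ≡ sum (map (length ∘ f) xs)
length-concatMap f [] = refl
length-concatMap f (x ∷ xs) = trans (LP.length-++ (f x)) (cong (length (f x) +_) (length-concatMap f xs))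

length-cartesianProductWith : ∀ {A B C : Set} (f : A → B → C) xs ys → length (cartesianProductWith f xs ys) ≡ length xs * length ys
length-cartesianProductWith f [] ys = refl
length-cartesianProductWith f (x ∷ xs) ys =
  trans (LP.length-++ (map (f x) ys)) (cong₂ _+_ (LP.length-map (f x) ys) (length-cartesianProductWith f xs ys))

allVecs≡cartesianProductWith : ∀ {A : Set} m (xs : List A) → allVecs (suc m) xs ≡ cartesianProductWith V._∷_ xs (allVecs m xs)
allVecs≡cartesianProductWith m xs = go xs
  where
  go : ∀ ys → concatMap (λ y → map (y V.∷_) (allVecs m xs)) ys ≡ cartesianProductWith V._∷_ ys (allVecs m xs)
  go [] = refl
  go (y ∷ ys) = cong (map (y V.∷_) (allVecs m xs) ++_) (go ys)

allVecs-unique : ∀ {A : Set} m (xs : List A) → Unique xs → Unique (allVecs m xs)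
allVecs-unique zero xs _ = [] ∷ []
allVecs-unique (suc m) xs unique = subst Unique (sym (allVecs≡cartesianProductWith m xs))
  (UP.cartesianProductWith⁺ V._∷_ (λ e → VP.∷-injectiveˡ e , VP.∷-injectiveʳ e) unique (allVecs-unique m xs unique))

∈-concatMap-intro : ∀ {A B : Set} (f : A → List B) {x y xs} → y ∈ f x → x ∈ xs → y ∈ concatMap f xs
∈-concatMap-intro f y∈fx x∈xs = ∈-concatMap⁺ f (Any.map (λ { refl → y∈fx }) x∈xs)

allVecs-complete : ∀ {A : Set} m (xs : List A) (v : Vec A m) → (∀ k → V.lookup v k ∈ xs) → v ∈ allVecs m xs
allVecs-complete zero xs V.[] _ = here refl
allVecs-complete (suc m) xs (x V.∷ v) entries∈ =
  ∈-concatMap-intro (λ y → map (y V.∷_) (allVecs m xs)) (∈-map⁺ (x V.∷_) (allVecs-complete m xs v (entries∈ ∘ fs))) (entries∈ fz)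

allTiles-unique : Unique allTiles
allTiles-unique = ((λ ()) ∷ (λ ()) ∷ (λ ()) ∷ (λ ()) ∷ (λ ()) ∷ []) ∷ ((λ ()) ∷ (λ ()) ∷ (λ ()) ∷ (λ ()) ∷ [])
                ∷ ((λ ()) ∷ (λ ()) ∷ (λ ()) ∷ []) ∷ ((λ ()) ∷ (λ ()) ∷ []) ∷ ((λ ()) ∷ []) ∷ [] ∷ []

∈-allTiles : ∀ t → t ∈ allTiles
∈-allTiles blank = here refl
∈-allTiles cross = there (here refl)
∈-allTiles hor = there (there (here refl))
∈-allTiles vert = there (there (there (here refl)))
∈-allTiles relb = there (there (there (there (here refl))))
∈-allTiles jelb = there (there (there (there (there (here refl)))))

allGrids-unique : ∀ m → Unique (allGrids m)
allGrids-unique m = allVecs-unique m _ (allVecs-unique m allTiles allTiles-unique)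

∈-allGrids : ∀ {m} (G : Grid m) → G ∈ allGrids m
∈-allGrids {m} G = allVecs-complete m _ G (λ r → allVecs-complete m allTiles (V.lookup G r) (λ c → ∈-allTiles _))

∈-filterᵇ⁺ : ∀ {A : Set} (p : A → Bool) {x xs} → x ∈ xs → p x ≡ true → x ∈ filterᵇ p xs
∈-filterᵇ⁺ p x∈xs px = ∈-filter⁺ (T? ∘ p) x∈xs (Equivalence.from T-≡ px)

∈-filterᵇ⁻ : ∀ {A : Set} (p : A → Bool) {x xs} → x ∈ filterᵇ p xs → p x ≡ true
∈-filterᵇ⁻ p {xs = xs} x∈ = Equivalence.to T-≡ (proj₂ (∈-filter⁻ (T? ∘ p) {xs = xs} x∈))

eqListℕ-refl : ∀ l → eqListℕ l l ≡ true
eqListℕ-refl [] = refl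
eqListℕ-refl (x ∷ l) rewrite ≡ᵇ-refl x = eqListℕ-refl l

isPermVec-oneLineVec : ∀ {m} (w : Permutation′ m) → isPermVec (oneLineVec w) ≡ true
isPermVec-oneLineVec w = allB⁺ _ λ a → allB⁺ _ λ b → distinct a b
  where
  distinct : ∀ a b → eqFin a b ∨ not (eqFin (V.lookup (oneLineVec w) a) (V.lookup (oneLineVec w) b)) ≡ true
  distinct a b with a FP.≟ b
  ... | yes refl rewrite ≡ᵇ-refl (toℕ a) = refl
  ... | no a≢b rewrite ≢⇒≡ᵇ-false (a≢b ∘ FP.toℕ-injective) | VP.lookup∘tabulate (w ⟨$⟩ʳ_) a | VP.lookup∘tabulate (w ⟨$⟩ʳ_) b
                     | ≢⇒≡ᵇ-false (a≢b ∘ perm-injective w ∘ FP.toℕ-injective) = refl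

module _ {m : ℕ} {F : Tiling} (w : Permutation′ m) where
  realises-oneLineVec⁺ : Realises m F (w ⟨$⟩ʳ_) → Realises m F (V.lookup (oneLineVec w))
  realises-oneLineVec⁺ h k = subst (λ c → ∃ λ l → pipeᶠ m F (toℕ c) ≡ just (toℕ k , l)) (sym (VP.lookup∘tabulate (w ⟨$⟩ʳ_) k)) (h k)

  realises-oneLineVec⁻ : Realises m F (V.lookup (oneLineVec w)) → Realises m F (w ⟨$⟩ʳ_)
  realises-oneLineVec⁻ h k = subst (λ c → ∃ λ l → pipeᶠ m F (toℕ c) ≡ just (toℕ k , l)) (VP.lookup∘tabulate (w ⟨$⟩ʳ_) k) (h k)

minimalBPDOf : ∀ {m} → Vec (Fin m) m → Grid m → Bool
minimalBPDOf u M = isReducedBPDOf u M ∧ minimalB M u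

isOccurrenceOf : ∀ {m} → Vec (Fin m) m → List ℕ → Bool
isOccurrenceOf u s = eqListℕ (standardize s) (V.toList (V.map toℕ u))

-- A witness (m, M, s) is a minimal BPD M of size m together with an occurrence s (the
-- subsequence of values) of its permutation in w.
Witness : Set
Witness = Σ ℕ λ m → Grid m × List ℕ

module Witnesses {n : ℕ} (v : Vec (Fin n) n) where
  occurrences : List (List ℕ)
  occurrences = subsequences (V.toList (V.map toℕ v))

  candidates : (m : ℕ) → Vec (Fin m) m → List Witness
  candidates m u = cartesianProductWith (λ M s → m , M , s) (filterᵇ (minimalBPDOf u) (allGrids m)) (filterᵇ (isOccurrenceOf u) occurrences)

  witnessesOf : (m : ℕ) → Vec (Fin m) m → List Witness
  witnessesOf m u = if containsB u v then candidates m u else []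

  witnesses : List Witness
  witnesses = concatMap (λ m → concatMap (witnessesOf m) (perms m)) (upTo (suc n))

  length-witnessesOf : ∀ m u → length (witnessesOf m u) ≡ (if containsB u v then mbpdCount u * patCount u v else 0)
  length-witnessesOf m u with containsB u v
  ... | true = length-cartesianProductWith _ (filterᵇ (minimalBPDOf u) (allGrids m)) (filterᵇ (isOccurrenceOf u) occurrences)
  ... | false = refl

  length-witnesses : length witnesses ≡ rhsSum v
  length-witnesses = trans (length-concatMap (λ m → concatMap (witnessesOf m) (perms m)) (upTo (suc n))) (cong sum (LP.map-cong (λ m →
    trans (length-concatMap (witnessesOf m) (perms m)) (cong sum (LP.map-cong (length-witnessesOf m) (perms m)))) (upTo (suc n))))

reinsert : ∀ {n} → Permutation′ n → Witness → Grid n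
reinsert {n} w (m , M , s) = fromTiling n (reinsertHooks n w (maskOf w s) (tileAt M))

module MinimiseBPD (n : ℕ) (w : Permutation′ n) (G : Grid n) (isBPD : isReducedBPDOf (oneLineVec w) G ≡ true) where
  open Witnesses (oneLineVec w)

  private
    valid×rest : locallyValid G ≡ true × (hasPerm G (oneLineVec w) ∧ reducedB G) ≡ true
    valid×rest = ∧-true⁻ isBPD
    perm×reduced : hasPerm G (oneLineVec w) ≡ true × reducedB G ≡ true
    perm×reduced = ∧-true⁻ (proj₂ valid×rest)

  open Minimisation (minimise n w (tileAt G) (tileAt-blankOutside G) (locallyValid-sound G (proj₁ valid×rest))
                      (realises-oneLineVec⁻ w (hasPerm-sound G (oneLineVec w) (proj₁ perm×reduced)))
                      (reducedB-sound G (proj₂ perm×reduced)))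

  M : Grid size
  M = fromTiling size core

  u : Vec (Fin size) size
  u = oneLineVec core-perm

  s : List ℕ
  s = select kept (oneLineℕ w)

  M≗core : tileAt M ≗₂ core
  M≗core = tileAt-fromTiling size core core-blankOutside

  M-minimal : minimalBPDOf u M ≡ true
  M-minimal = ∧-true (∧-true (locallyValid-complete M M≗core core-locallyValid) (∧-true realises-u (reducedB-complete M M≗core core-reduced)))
                     (cong not (anyB-false _ none-removable))
    where
    realises-u : hasPerm M u ≡ true
    realises-u = hasPerm-complete M u λ k → let (l , h) = realises-oneLineVec⁺ core-perm core-realises k in
      l , trans (pipeᶠ-cong size M≗core _) h
    none-removable : ∀ k → removable M u k ≡ false
    none-removable k = trans (removable≡removableᶠ M u k)
      (trans (removableᶠ-cong size M≗core _ _ (VP.lookup∘tabulate (core-perm ⟨$⟩ʳ_)) k) (core-minimal k))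

  s-occurrence : isOccurrenceOf u s ≡ true
  s-occurrence = subst (λ l → eqListℕ l (V.toList (V.map toℕ u)) ≡ true) (sym occurrence) (eqListℕ-refl (V.toList (oneLineℕ core-perm)))

  witness∈witnesses : (size , M , s) ∈ witnesses
  witness∈witnesses = ∈-concatMap-intro (λ m → concatMap (witnessesOf m) (perms m))
    (∈-concatMap-intro (witnessesOf size) witness∈witnessesOf u∈perms) (∈-upTo⁺ (s≤s size≤m))
    where
    s∈ : s ∈ filterᵇ (isOccurrenceOf u) occurrences
    s∈ = ∈-filterᵇ⁺ (isOccurrenceOf u) (select∈subsequences kept (oneLineℕ w)) s-occurrence
    u-contained : containsB u (oneLineVec w) ≡ true
    u-contained = ≤ᵇ-complete (∈-length s∈)
    witness∈witnessesOf : (size , M , s) ∈ witnessesOf size u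
    witness∈witnessesOf = subst (λ b → (size , M , s) ∈ (if b then candidates size u else [])) (sym u-contained)
      (∈-cartesianProductWith⁺ (λ M s → size , M , s) (∈-filterᵇ⁺ (minimalBPDOf u) (∈-allGrids M) M-minimal) s∈)
    u∈perms : u ∈ perms size
    u∈perms = ∈-filterᵇ⁺ isPermVec (allVecs-complete size (allFin size) u (λ k → ∈-allFin _)) (isPermVec-oneLineVec core-perm)

  reinsert-witness : reinsert w (size , M , s) ≡ G
  reinsert-witness rewrite maskOf-select w kept = fromTiling-tileAt n G _ λ r c r<n c<n →
    trans (reinsertHooks-cong n w kept M≗core r c) (sym (reconstructs r c r<n c<n))

mainTheorem4 : (n : ℕ) (w : Permutation′ n) →
    bpdCount (oneLineVec w) ≤ rhsSum (oneLineVec w)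
mainTheorem4 n w = begin
  length bpds                          ≤⟨ length-≤-⊆ bpds (map (reinsert w) witnesses) bpds-unique bpd∈reinserted ⟩
  length (map (reinsert w) witnesses)  ≡⟨ LP.length-map (reinsert w) witnesses ⟩
  length witnesses                     ≡⟨ length-witnesses ⟩
  rhsSum (oneLineVec w) ∎
  where
  open ≤-Reasoning
  open Witnesses (oneLineVec w)
  bpds : List (Grid n)
  bpds = filterᵇ (isReducedBPDOf (oneLineVec w)) (allGrids n)
  bpds-unique : Unique bpds
  bpds-unique = UP.filter⁺ (T? ∘ isReducedBPDOf (oneLineVec w)) (allGrids-unique n)
  bpd∈reinserted : ∀ {G} → G ∈ bpds → G ∈ map (reinsert w) witnesses
  bpd∈reinserted {G} G∈ = subst (_∈ map (reinsert w) witnesses) B.reinsert-witness (∈-map⁺ (reinsert w) B.witness∈witnesses)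
    where module B = MinimiseBPD n w G (∈-filterᵇ⁻ (isReducedBPDOf (oneLineVec w)) {xs = allGrids n} G∈)
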